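{- Let $k\ge1$ and let $(G,\Sigma)$ be a non-decomposable $k$-critical signed graph with at least three vertices. Then $(G,\Sigma)$ is a proper subdivision of some signed graph $(H,\Gamma)$ if and only if $G$ has a vertex with precisely two neighbors.
   Context: A signed graph $(G,\Sigma)$ is a finite graph $G$ (loops and multiple edges allowed) with a set $\Sigma\subseteq E(G)$ of negative edges. A circuit is negative if it has an odd number of edges in $\Sigma$; $(G,\Sigma)$ is balanced if it has no negative circuit. For $U\subseteq V(G)$, $\partial(U)$ is the set of edges with exactly one end in $U$; a signature of $(G,\Sigma)$ is any set $\Sigma\,\Delta\,\partial(U)$, and signed graphs are regarded up to such switching (so "$(G,\Sigma)$ is a subdivision of $(H,\Gamma)$" means $(G,\Sigma')$ is one for some signature $\Sigma'$ of $(G,\Sigma)$). The frustration index $l(G,\Sigma)$ is the minimum size of $E\subseteq E(G)$ with $(G-E,\Sigma-E)$ balanced. For $k\ge1$, $(G,\Sigma)$ is $k$-critical if $l(G,\Sigma)=k$ and $l(G-e,\Sigma-\{e\})<k$ for every $e$. A $k$-critical signed graph is decomposable if for some $n\ge2$ and positive integers $k_1,\dots,k_n$ with sum $k$ it contains pairwise edge-disjoint subgraphs $(H_i,\Sigma\cap E(H_i))$ which are $k_i$-critical; otherwise non-decomposable. A $t$-multiedge $E_{xy}$ is a set of $t\ge1$ edges between $x$ and $y$; it has a sign if all its edges are positive or all negative. Subdividing a signed $t$-multiedge $E_{xy}$: delete $E_{xy}$, add a new vertex $v$, $t$ positive edges $vx$ and $t$ edges $vy$ of the same sign as $E_{xy}$.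 A subdivision is obtained by a finite (possibly empty) sequence of such operations; a proper subdivision uses a nonempty sequence. -}

module Defs where

open import Data.Nat using (ℕ; zero; suc; _≤_; _<_; _%_)
open import Data.Bool using (Bool; true; false; _xor_)
open import Data.Fin using (Fin; zero; suc)
open import Data.Fin.Subset using (Subset; _∈_; _⊆_; _─_; _-_; _∩_; ∣_∣; Empty; ⊤)
open import Data.Vec using (tabulate)
open import Data.Product using (Σ; ∃; ∃-syntax; _×_; _,_; proj₁; proj₂)
open import Data.Sum using (_⊎_)
open import Data.List using (List; length; map)
open import Data.Nat.ListAction using (sum)
open import Data.List.Relation.Unary.All using (All)
open import Data.List.Relation.Unary.AllPairs using (AllPairs)
open import Relation.Binary.PropositionalEquality using (_≡_; _≢_)
open import Relation.Binary.Construct.Closure.Transitive using (TransClosure)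
open import Relation.Nullary using (¬_)
open import Function.Definitions using (Injective)
open import Function.Bundles using (_⤖_)

-- Signed graphs: finitely many vertices (Fin nv) and edges (Fin ne);
-- each edge has two ends (loops: equal ends; multiple edges allowed)
-- and a sign (neg e ≡ true means e ∈ Σ).

record SGraph : Set where
  field
    nv   : ℕ
    ne   : ℕ
    ends : Fin ne → Fin nv × Fin nv
    neg  : Fin ne → Bool
open SGraph public

Joins : (G : SGraph) → Fin (ne G) → Fin (nv G) → Fin (nv G) → Set
Joins G e x y = (ends G e ≡ (x , y)) ⊎ (ends G e ≡ (y , x))

next : ∀ {l} → Fin (suc l) → Fin (suc l)
next {zero}  _ = zero
next {suc l} zero = suc zero
next {suc l} (suc i) with next {l} i
... | zero  = zero
... | suc j = suc (suc j)

record Circuit (G : SGraph) (S : Subset (ne G)) : Set where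
  field
    len    : ℕ
    vs     : Fin (suc len) → Fin (nv G)
    es     : Fin (suc len) → Fin (ne G)
    vs-inj : Injective _≡_ _≡_ vs
    es-inj : Injective _≡_ _≡_ es
    es-in  : ∀ i → es i ∈ S
    link   : ∀ i → Joins G (es i) (vs i) (vs (next i))
open Circuit public

NegativeCircuit : (G : SGraph) {S : Subset (ne G)} → Circuit G S → Set
NegativeCircuit G C = ∣ tabulate (λ i → neg G (es C i)) ∣ % 2 ≡ 1

Balanced : (G : SGraph) → Subset (ne G) → Set
Balanced G S = ¬ (Σ (Circuit G S) (NegativeCircuit G))

FrustrationIndex : (G : SGraph) → Subset (ne G) → ℕ → Set
FrustrationIndex G S k =
  (∃[ E ] (E ⊆ S × ∣ E ∣ ≡ k × Balanced G (S ─ E)))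
  × (∀ E → E ⊆ S → Balanced G (S ─ E) → k ≤ ∣ E ∣)

Critical : (G : SGraph) → Subset (ne G) → ℕ → Set
Critical G S k =
  FrustrationIndex G S k
  × (∀ e → e ∈ S → ∃[ j ] (j < k × FrustrationIndex G (S - e) j))

-- G (assumed k-critical) is decomposable: n ≥ 2 pairwise edge-disjoint
-- subgraphs (given by edge sets Sᵢ, with the inherited signature) which
-- are kᵢ-critical, kᵢ ≥ 1, Σ kᵢ = k.
Decomposable : (G : SGraph) → ℕ → Set
Decomposable G k =
  ∃[ parts ] (2 ≤ length parts
    × All (λ (p : ℕ × Subset (ne G)) → 1 ≤ proj₁ p × Critical G (proj₂ p) (proj₁ p)) parts
    × sum (map proj₁ parts) ≡ k
    × AllPairs (λ p q → Empty (proj₂ p ∩ proj₂ q)) parts)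

switch : (G : SGraph) → (Fin (nv G) → Bool) → SGraph
switch G U = record
  { nv = nv G ; ne = ne G ; ends = ends G
  ; neg = λ e → neg G e xor (U (proj₁ (ends G e)) xor U (proj₂ (ends G e))) }

-- edges of the graph obtained from H by subdividing the multiedge inE
data NewEdge (H : SGraph) (inE : Fin (ne H) → Bool) : Set where
  old : (e : Fin (ne H)) → inE e ≡ false → NewEdge H inE
  toX : (e : Fin (ne H)) → inE e ≡ true → NewEdge H inE
  toY : (e : Fin (ne H)) → inE e ≡ true → NewEdge H inE

-- Subdiv1 H G : G is (isomorphic to) the signed graph obtained from H by
-- subdividing a signed t-multiedge E_xy (t ≥ 1, x ≠ y): delete E_xy, add
-- a new vertex v, t positive edges vx and t edges vy of the sign of E_xy.
record Subdiv1 (H G : SGraph) : Set where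
  field
    x y      : Fin (nv H)
    x≢y      : x ≢ y
    inE      : Fin (ne H) → Bool
    inE-join : ∀ e → inE e ≡ true → Joins H e x y
    s        : Bool
    inE-sign : ∀ e → inE e ≡ true → neg H e ≡ s
    nonempty : ∃[ e ] (inE e ≡ true)
    -- vertices of G: φ(V(H)) plus the new vertex v
    v        : Fin (nv G)
    φ        : Fin (nv H) → Fin (nv G)
    φ-inj    : Injective _≡_ _≡_ φ
    φ-≢v     : ∀ u → φ u ≢ v
    φ-onto   : ∀ w → w ≢ v → ∃[ u ] (φ u ≡ w)
    ψ        : Fin (ne G) ⤖ NewEdge H inE
    ψ-old    : ∀ g e p → Function.Bundles.Bijection.to ψ g ≡ old e p →
                 Joins G g (φ (proj₁ (ends H e))) (φ (proj₂ (ends H e)))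
                 × neg G g ≡ neg H e
    ψ-toX    : ∀ g e p → Function.Bundles.Bijection.to ψ g ≡ toX e p →
                 Joins G g v (φ x) × neg G g ≡ false
    ψ-toY    : ∀ g e p → Function.Bundles.Bijection.to ψ g ≡ toY e p →
                 Joins G g v (φ y) × neg G g ≡ s

-- (G,Σ) is a proper subdivision of (H,Γ): for some signature of (G,Σ),
-- obtained from (H,Γ) by a nonempty finite sequence of subdivisions.
ProperSubdivisionOf : SGraph → SGraph → Set
ProperSubdivisionOf G H = ∃[ U ] TransClosure Subdiv1 H (switch G U)

IsProperSubdivision : SGraph → Set
IsProperSubdivision G = ∃[ H ] ProperSubdivisionOf G H

Adjacent : (G : SGraph) → Fin (nv G) → Fin (nv G) → Set
Adjacent G u w = ∃[ e ] Joins G e u w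

HasVertexWithTwoNeighbours : SGraph → Set
HasVertexWithTwoNeighbours G =
  ∃[ w ] ∃[ a ] ∃[ b ] (a ≢ b × a ≢ w × b ≢ w × Adjacent G w a × Adjacent G w b
    × (∀ u → u ≢ w → Adjacent G w u → (u ≡ a ⊎ u ≡ b)))

-- A subdivision vertex has exactly the two neighbours of the subdivided multiedge, and
-- switching does not change adjacency.
--
-- Conversely, let w have exactly the neighbours a and b. A loop at w is impossible: a positive
-- loop lies on no negative circuit, and a negative one would split off as a 1-critical part.
-- All w–a edges have one sign: two of opposite signs form a negative digon D, and G − D keeps
-- frustration k − 1, because a smaller balancing set F of G − D would make both digon edges
-- close negative circuits over G − D − F, whose two detours form a negative closed walk in
-- G − D − F; so D splits off. Likewise for w–b. There are as many w–a as w–b edges: with fewer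
-- w–a edges, a balancing set of G − e for a w–b edge e could trade its w–b edges for the w–a
-- edges and balance G with fewer than k edges. Switching at w to make the w–a edges positive
-- and pairing w–a with w–b edges then exhibits G as the subdivision of the a–b multiedge of
-- the graph with w removed.
module Submission where

open import Level using (0ℓ)
open import Data.Nat using (ℕ; zero; suc; _+_; _≤_; _<_; _%_; z≤n; s≤s; _≤?_)
open import Data.Nat.Properties
  using (≤-refl; ≤-trans; ≤-reflexive; ≤-antisym; ≤-pred; <-irrefl; n≮0; ≮⇒≥; module ≤-Reasoning;
         +-comm; +-suc; +-identityʳ; +-monoʳ-≤; +-monoʳ-<; m≤n+m; n≤1+n)
open import Data.Bool using (Bool; true; false; not; _xor_; if_then_else_)
open import Data.Bool.Properties using (xor-assoc; xor-comm; xor-same; xor-identityʳ; ¬-not; not-¬)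
  renaming (_≟_ to _≟ᵇ_)
open import Data.Fin using (Fin; zero; suc; toℕ; fromℕ; inject₁; punchIn; punchOut; cast; _≟_)
open import Data.Fin.Properties
  using (any?; suc-injective; toℕ-fromℕ; toℕ-inject₁; punchIn-injective; punchInᵢ≢i; punchIn-punchOut;
         punchOut-injective; cast-involutive)
open import Data.Fin.Subset
  using (Subset; _∈_; _∉_; _⊆_; _─_; _-_; _∩_; _∪_; ∣_∣; Empty; Nonempty; ⊤; ⊥; ⁅_⁆; ∁)
open import Data.Fin.Subset.Properties
  using (_∈?_; nonempty?; Empty-unique; ∈⊤; ∉⊥; ∣⊥∣≡0; x∈⁅x⁆; x∈⁅y⁆⇒x≡y; x∉⁅y⁆⇒x≢y; ∣⁅x⁆∣≡1;
         x∈p∪q⁺; x∈p∪q⁻; x∈p∩q⁺; x∈p∩q⁻; p─q⊆p; x∈p∧x∉q⇒x∈p─q; x∈p∧x≢y⇒x∈p-y;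
         x∈p⇒∣p-x∣<∣p∣; p⊆q⇒∣p∣≤∣q∣; p─q─r≡p─q∪r; x∉p⇒x∈∁p; x∈∁p⇒x∉p)
open import Data.Vec using ([]; _∷_; tabulate; here; there)
open import Data.Vec.Properties using (lookup∘tabulate; []=⇒lookup; lookup⇒[]=)
open import Data.Vec.Properties.WithK using ([]=-irrelevant)
open import Data.List using ([]; _∷_)
open import Data.List.Relation.Unary.All using ([]; _∷_)
open import Data.List.Relation.Unary.AllPairs using ([]; _∷_)
open import Data.Product using (Σ; ∃; ∃-syntax; _×_; _,_; proj₁; proj₂)
open import Data.Product.Properties using (≡-dec)
open import Data.Sum using (_⊎_; inj₁; inj₂; swap; [_,_]′)
open import Data.Empty using () renaming (⊥ to Void; ⊥-elim to void)
open import Data.Unit using (tt) renaming (⊤ to Unit)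
open import Axiom.UniquenessOfIdentityProofs.WithK using (uip)
open import Effect.Monad using (RawMonad)
open import Relation.Binary.PropositionalEquality
open import Relation.Binary.Construct.Closure.Transitive using (TransClosure; [_]; _∷_)
open import Relation.Nullary using (¬_; Dec; yes; no; ¬?)
open import Relation.Nullary.Decidable using (_⊎-dec_; _×-dec_; isYes; decidable-stable; ¬¬-excluded-middle)
open import Relation.Nullary.Negation using (¬¬-Monad)
open import Function using (_∘_; _$_; case_of_; _⇔_; mk⇔)
open import Function.Definitions using (Injective)
open import Function.Bundles using (_⤖_; mk⤖; Bijection)
open import Defs

next-inject₁ : ∀ {l} (j : Fin l) → next (inject₁ j) ≡ suc j
next-inject₁ {suc l} zero = refl
next-inject₁ {suc l} (suc j) rewrite next-inject₁ j = refl

next-fromℕ : ∀ l → next (fromℕ l) ≡ zero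
next-fromℕ zero = refl
next-fromℕ (suc l) rewrite next-fromℕ l = refl

data LastOrInject₁ {l : ℕ} : Fin (suc l) → Set where
  last   : LastOrInject₁ (fromℕ l)
  inject : (j : Fin l) → LastOrInject₁ (inject₁ j)

lastOrInject₁ : ∀ {l} (i : Fin (suc l)) → LastOrInject₁ i
lastOrInject₁ {zero} zero = last
lastOrInject₁ {suc l} zero = inject zero
lastOrInject₁ {suc l} (suc i) with lastOrInject₁ i
... | last = last
... | inject j = inject (suc j)

next-surjective : ∀ {l} (i : Fin (suc l)) → ∃[ j ] next j ≡ i
next-surjective {l} zero = fromℕ l , next-fromℕ l
next-surjective (suc i) = inject₁ i , next-inject₁ i

next-injective : ∀ {l} → Injective _≡_ _≡_ (next {l})
next-injective {l} {i} {j} eq with lastOrInject₁ i | lastOrInject₁ j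
... | last     | last     = refl
... | last     | inject j rewrite next-fromℕ l | next-inject₁ j with () ← eq
... | inject i | last     rewrite next-fromℕ l | next-inject₁ i with () ← eq
... | inject i | inject j rewrite next-inject₁ i | next-inject₁ j = cong inject₁ (suc-injective eq)

toℕ-next : ∀ {l} (i : Fin (suc l)) → (toℕ i ≡ l × next i ≡ zero) ⊎ toℕ (next i) ≡ suc (toℕ i)
toℕ-next {l} i with lastOrInject₁ i
... | last = inj₁ (toℕ-fromℕ l , next-fromℕ l)
... | inject j rewrite next-inject₁ j = inj₂ (cong suc (sym (toℕ-inject₁ j)))

next-fixed⇒l≡0 : ∀ {l} (i : Fin (suc l)) → next i ≡ i → l ≡ 0
next-fixed⇒l≡0 i eq with toℕ-next i
... | inj₁ (i≡l , next≡0) = trans (sym i≡l) (cong toℕ (trans (sym eq) next≡0))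
... | inj₂ next≡suc = void (n≢1+n (trans (sym (cong toℕ eq)) next≡suc))
  where n≢1+n : ∀ {n} → n ≢ suc n
        n≢1+n ()

next-involution⇒l≡1 : ∀ {l} (i : Fin (suc l)) → next (next i) ≡ i → next i ≢ i → l ≡ 1
next-involution⇒l≡1 {l} i nn≡i n≢i with toℕ-next i | toℕ-next (next i)
... | inj₁ (_ , n≡0)   | inj₁ (_ , nn≡0) = void (n≢i (trans n≡0 (trans (sym nn≡0) nn≡i)))
... | inj₁ (i≡l , n≡0) | inj₂ nn≡sn     =
  trans (sym i≡l) (trans (cong toℕ (sym nn≡i)) (trans nn≡sn (cong (suc ∘ toℕ) n≡0)))
... | inj₂ n≡si        | inj₁ (n≡l , nn≡0) =
  trans (sym n≡l) (trans n≡si (cong (suc ∘ toℕ) (trans (sym nn≡i) nn≡0)))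
... | inj₂ n≡si        | inj₂ nn≡sn     = void (n≢2+n (trans (cong toℕ (sym nn≡i)) (trans nn≡sn (cong suc n≡si))))
  where n≢2+n : ∀ {n} → n ≢ suc (suc n)
        n≢2+n ()

parity : ∀ {n} → (Fin n → Bool) → Bool
parity {zero} f = false
parity {suc n} f = f zero xor parity (f ∘ suc)

parity-cong : ∀ {n} {f g : Fin n → Bool} → (∀ i → f i ≡ g i) → parity f ≡ parity g
parity-cong {zero} f≗g = refl
parity-cong {suc n} f≗g = cong₂ _xor_ (f≗g zero) (parity-cong (f≗g ∘ suc))

parity-snoc : ∀ {m} (f : Fin (suc m) → Bool) → parity f ≡ parity (f ∘ inject₁) xor f (fromℕ m)
parity-snoc {zero} f = xor-comm (f zero) false
parity-snoc {suc m} f = trans (cong (f zero xor_) (parity-snoc (f ∘ suc))) (sym (xor-assoc (f zero) _ _))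

parity-∘next : ∀ {l} (f : Fin (suc l) → Bool) → parity (f ∘ next) ≡ parity f
parity-∘next {l} f = begin
  parity (f ∘ next)                                 ≡⟨ parity-snoc (f ∘ next) ⟩
  parity (f ∘ next ∘ inject₁) xor f (next (fromℕ l)) ≡⟨ cong₂ _xor_ (parity-cong (cong f ∘ next-inject₁)) (cong f (next-fromℕ l)) ⟩
  parity (f ∘ suc) xor f zero                       ≡⟨ xor-comm (parity (f ∘ suc)) (f zero) ⟩
  parity f                                          ∎
  where open ≡-Reasoning

parity-singleton : ∀ {l} → l ≡ 0 → (f : Fin (suc l) → Bool) (i : Fin (suc l)) → parity f ≡ f i
parity-singleton refl f zero = xor-identityʳ (f zero)

parity-pair-equal : ∀ {l} → l ≡ 1 → (f : Fin (suc l) → Bool) {i m : Fin (suc l)} → i ≢ m → f i ≡ f m → parity f ≡ false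
parity-pair-equal refl f {zero}     {zero}     i≢m _ = void (i≢m refl)
parity-pair-equal refl f {zero}     {suc zero} _ eq =
  trans (cong (f zero xor_) (xor-identityʳ _)) (trans (cong (_xor f (suc zero)) eq) (xor-same (f (suc zero))))
parity-pair-equal refl f {suc zero} {zero}     i≢m eq = parity-pair-equal refl f (i≢m ∘ sym) (sym eq)
parity-pair-equal refl f {suc zero} {suc zero} i≢m _ = void (i≢m refl)

false≢true : false ≢ true
false≢true ()

private
  bit : Bool → ℕ
  bit b = if b then 1 else 0

  suc-%2 : ∀ m b → m % 2 ≡ bit b → suc m % 2 ≡ bit (not b)
  suc-%2 zero false _ = refl
  suc-%2 (suc zero) true _ = refl
  suc-%2 (suc (suc m)) b h = suc-%2 m b h

  ∣tabulate∣%2 : ∀ {n} (f : Fin n → Bool) → ∣ tabulate f ∣ % 2 ≡ bit (parity f)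
  ∣tabulate∣%2 {zero} f = refl
  ∣tabulate∣%2 {suc n} f with f zero
  ... | true = suc-%2 ∣ tabulate (f ∘ suc) ∣ (parity (f ∘ suc)) (∣tabulate∣%2 (f ∘ suc))
  ... | false = ∣tabulate∣%2 (f ∘ suc)

  bit≡1⇒true : ∀ {b} → bit b ≡ 1 → b ≡ true
  bit≡1⇒true {true} _ = refl

sign : (G : SGraph) {S : Subset (ne G)} → Circuit G S → Bool
sign G C = parity (neg G ∘ es C)

negative⇒sign : (G : SGraph) {S : Subset (ne G)} (C : Circuit G S) → NegativeCircuit G C → sign G C ≡ true
negative⇒sign G C odd = bit≡1⇒true (trans (sym (∣tabulate∣%2 (neg G ∘ es C))) odd)

sign⇒negative : (G : SGraph) {S : Subset (ne G)} (C : Circuit G S) → sign G C ≡ true → NegativeCircuit G C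
sign⇒negative G C s≡true = trans (∣tabulate∣%2 (neg G ∘ es C)) (cong bit s≡true)

x∈p─q⇒x∉q : ∀ {n} (p q : Subset n) {x} → x ∈ p ─ q → x ∉ q
x∈p─q⇒x∉q (_ ∷ p) (false ∷ q) (there x∈p─q) (there x∈q) = x∈p─q⇒x∉q p q x∈p─q x∈q
x∈p─q⇒x∉q (_ ∷ p) (true ∷ q)  (there x∈p─q) (there x∈q) = x∈p─q⇒x∉q p q x∈p─q x∈q

x∈p-y⇒x≢y : ∀ {n} (p : Subset n) {x y} → x ∈ p - y → x ≢ y
x∈p-y⇒x≢y p {y = y} x∈p-y refl = x∈p─q⇒x∉q p ⁅ y ⁆ x∈p-y (x∈⁅x⁆ y)

∣p∪q∣≤∣p∣+∣q∣ : ∀ {n} (p q : Subset n) → ∣ p ∪ q ∣ ≤ ∣ p ∣ + ∣ q ∣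
∣p∪q∣≤∣p∣+∣q∣ [] [] = z≤n
∣p∪q∣≤∣p∣+∣q∣ (true ∷ p)  (true ∷ q)  = s≤s (≤-trans (∣p∪q∣≤∣p∣+∣q∣ p q) (≤-trans (n≤1+n _) (≤-reflexive (sym (+-suc ∣ p ∣ ∣ q ∣)))))
∣p∪q∣≤∣p∣+∣q∣ (true ∷ p)  (false ∷ q) = s≤s (∣p∪q∣≤∣p∣+∣q∣ p q)
∣p∪q∣≤∣p∣+∣q∣ (false ∷ p) (true ∷ q)  = ≤-trans (s≤s (∣p∪q∣≤∣p∣+∣q∣ p q)) (≤-reflexive (sym (+-suc ∣ p ∣ ∣ q ∣)))
∣p∪q∣≤∣p∣+∣q∣ (false ∷ p) (false ∷ q) = ∣p∪q∣≤∣p∣+∣q∣ p q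

∣p─q∣+∣p∩q∣≡∣p∣ : ∀ {n} (p q : Subset n) → ∣ p ─ q ∣ + ∣ p ∩ q ∣ ≡ ∣ p ∣
∣p─q∣+∣p∩q∣≡∣p∣ [] [] = refl
∣p─q∣+∣p∩q∣≡∣p∣ (true ∷ p)  (true ∷ q)  = trans (+-suc ∣ p ─ q ∣ ∣ p ∩ q ∣) (cong suc (∣p─q∣+∣p∩q∣≡∣p∣ p q))
∣p─q∣+∣p∩q∣≡∣p∣ (true ∷ p)  (false ∷ q) = cong suc (∣p─q∣+∣p∩q∣≡∣p∣ p q)
∣p─q∣+∣p∩q∣≡∣p∣ (false ∷ p) (true ∷ q)  = ∣p─q∣+∣p∩q∣≡∣p∣ p q
∣p─q∣+∣p∩q∣≡∣p∣ (false ∷ p) (false ∷ q) = ∣p─q∣+∣p∩q∣≡∣p∣ p q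

∣p∣≡0⇒x∉p : ∀ {n} {p : Subset n} {x} → ∣ p ∣ ≡ 0 → x ∉ p
∣p∣≡0⇒x∉p {p = p} {x} ∣p∣≡0 x∈p = n≮0 (subst (∣ p - x ∣ <_) ∣p∣≡0 (x∈p⇒∣p-x∣<∣p∣ x∈p))

∣p∣>0⇒Nonempty : ∀ {n} (p : Subset n) → 1 ≤ ∣ p ∣ → Nonempty p
∣p∣>0⇒Nonempty {n} p ∣p∣>0 with nonempty? p
... | yes ne = ne
... | no ¬ne = void (n≮0 (subst (0 <_) (trans (cong ∣_∣ (Empty-unique ¬ne)) (∣⊥∣≡0 n)) ∣p∣>0))

∪-⊆ : ∀ {n} {p q r : Subset n} → p ⊆ r → q ⊆ r → p ∪ q ⊆ r
∪-⊆ {p = p} {q} p⊆r q⊆r x∈p∪q with x∈p∪q⁻ p q x∈p∪q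
... | inj₁ x∈p = p⊆r x∈p
... | inj₂ x∈q = q⊆r x∈q

⁅x⁆⊆p : ∀ {n} {x : Fin n} {p} → x ∈ p → ⁅ x ⁆ ⊆ p
⁅x⁆⊆p {x = x} x∈p y∈⁅x⁆ = subst (_∈ _) (sym (x∈⁅y⁆⇒x≡y x y∈⁅x⁆)) x∈p

∣p─q∣+∣q∣≤∣p∣ : ∀ {n} {p q : Subset n} → q ⊆ p → ∣ p ─ q ∣ + ∣ q ∣ ≤ ∣ p ∣
∣p─q∣+∣q∣≤∣p∣ {p = p} {q} q⊆p = begin
  ∣ p ─ q ∣ + ∣ q ∣      ≤⟨ +-monoʳ-≤ ∣ p ─ q ∣ (p⊆q⇒∣p∣≤∣q∣ (λ x∈q → x∈p∩q⁺ (q⊆p x∈q , x∈q))) ⟩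
  ∣ p ─ q ∣ + ∣ p ∩ q ∣  ≡⟨ ∣p─q∣+∣p∩q∣≡∣p∣ p q ⟩
  ∣ p ∣                  ∎
  where open ≤-Reasoning

swapped-steps⇒l≡1 : ∀ {l} {A : Set} (f : Fin (suc l) → A) → Injective _≡_ _≡_ f → ∀ {i m} → i ≢ m
  → (f i ≡ f m × f (next i) ≡ f (next m)) ⊎ (f i ≡ f (next m) × f (next i) ≡ f m) → l ≡ 1
swapped-steps⇒l≡1 f f-inj i≢m (inj₁ (fi≡fm , _)) = void (i≢m (f-inj fi≡fm))
swapped-steps⇒l≡1 f f-inj {i} {m} i≢m (inj₂ (fi≡fnm , fni≡fm)) =
  next-involution⇒l≡1 i (trans (cong next ni≡m) (sym i≡nm)) (λ ni≡i → i≢m (trans (sym ni≡i) ni≡m))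
  where
  i≡nm = f-inj fi≡fnm
  ni≡m = f-inj fni≡fm

module _ (G : SGraph) where

  private
    V = Fin (nv G)
    E = Fin (ne G)

  Joins-sym : ∀ {e x y} → Joins G e x y → Joins G e y x
  Joins-sym (inj₁ p) = inj₂ p
  Joins-sym (inj₂ p) = inj₁ p

  Joins-unique : ∀ {e x y x' y'} → Joins G e x y → Joins G e x' y' → (x ≡ x' × y ≡ y') ⊎ (x ≡ y' × y ≡ x')
  Joins-unique (inj₁ p) (inj₁ q) with refl ← trans (sym p) q = inj₁ (refl , refl)
  Joins-unique (inj₁ p) (inj₂ q) with refl ← trans (sym p) q = inj₂ (refl , refl)
  Joins-unique (inj₂ p) (inj₁ q) with refl ← trans (sym p) q = inj₂ (refl , refl)
  Joins-unique (inj₂ p) (inj₂ q) with refl ← trans (sym p) q = inj₁ (refl , refl)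

  Joins-parallel : ∀ {e f x y s t} → Joins G f x y → Joins G e x y → Joins G e s t → Joins G f s t
  Joins-parallel f-xy e-xy e-st with Joins-unique e-xy e-st
  ... | inj₁ (refl , refl) = f-xy
  ... | inj₂ (refl , refl) = Joins-sym f-xy

  Joins? : ∀ e x y → Dec (Joins G e x y)
  Joins? e x y = ≡-dec _≟_ _≟_ (ends G e) (x , y) ⊎-dec ≡-dec _≟_ _≟_ (ends G e) (y , x)

  restrict : ∀ {S S'} (C : Circuit G S) → (∀ i → es C i ∈ S') → Circuit G S'
  restrict C es-in' = record
    { len = len C ; vs = vs C ; es = es C ; vs-inj = vs-inj C ; es-inj = es-inj C
    ; es-in = es-in' ; link = link C }

  module _ {l} (vs : Fin (suc l) → V) (es : Fin (suc l) → E) (vs-inj : Injective _≡_ _≡_ vs)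
           (link : ∀ i → Joins G (es i) (vs i) (vs (next i))) where

    -- A closed trail with two parallel edges of equal sign is a digon, hence positive.
    parallel-steps⇒parity-false : ∀ {i m x y} → i ≢ m → Joins G (es i) x y → Joins G (es m) x y
      → neg G (es i) ≡ neg G (es m) → parity (neg G ∘ es) ≡ false
    parallel-steps⇒parity-false {i} {m} i≢m i-xy m-xy sg =
      parity-pair-equal (swapped-steps⇒l≡1 vs vs-inj i≢m steps) (neg G ∘ es) i≢m sg
      where
      steps : (vs i ≡ vs m × vs (next i) ≡ vs (next m)) ⊎ (vs i ≡ vs (next m) × vs (next i) ≡ vs m)
      steps with Joins-unique i-xy (link i) | Joins-unique m-xy (link m)
      ... | inj₁ (p , q) | inj₁ (p' , q') = inj₁ (trans (sym p) p' , trans (sym q) q')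
      ... | inj₁ (p , q) | inj₂ (p' , q') = inj₂ (trans (sym p) p' , trans (sym q) q')
      ... | inj₂ (p , q) | inj₁ (p' , q') = inj₂ (trans (sym q) q' , trans (sym p) p')
      ... | inj₂ (p , q) | inj₂ (p' , q') = inj₁ (trans (sym q) q' , trans (sym p) p')

  module _ {S : Subset (ne G)} (C : Circuit G S) where

    parallel-edges⇒positive : ∀ {i m x y} → i ≢ m → Joins G (es C i) x y → Joins G (es C m) x y
      → neg G (es C i) ≡ neg G (es C m) → ¬ NegativeCircuit G C
    parallel-edges⇒positive i≢m i-xy m-xy sg negC = false≢true $
      trans (sym (parallel-steps⇒parity-false (vs C) (es C) (vs-inj C) (link C) i≢m i-xy m-xy sg)) (negative⇒sign G C negC)

    positive-loop⇒positive : ∀ i {u} → ends G (es C i) ≡ (u , u) → neg G (es C i) ≡ false → ¬ NegativeCircuit G C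
    positive-loop⇒positive i loop positive negC = false≢true $
      trans (sym (trans (parity-singleton (next-fixed⇒l≡0 i (vs-inj C fixed)) (neg G ∘ es C) i) positive))
            (negative⇒sign G C negC)
      where
      fixed : vs C (next i) ≡ vs C i
      fixed with Joins-unique (link C i) (inj₁ loop)
      ... | inj₁ (p , q) = trans q (sym p)
      ... | inj₂ (p , q) = trans q (sym p)

    another-edge-at : ∀ {w b} → w ≢ b → (∀ c u → c ∈ S → Joins G c w u → Joins G c w b)
      → ∀ i → Joins G (es C i) w b → ∃[ m ] (m ≢ i × Joins G (es C m) w b)
    another-edge-at {w} {b} w≢b at-w i i-wb with Joins-unique i-wb (link C i)
    ... | inj₂ (w≡vni , b≡vi) =
      next i , (λ ni≡i → w≢b (trans w≡vni (trans (cong (vs C) ni≡i) (sym b≡vi))))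
      , at-w _ (vs C (next (next i))) (es-in C (next i))
               (subst (λ z → Joins G (es C (next i)) z (vs C (next (next i)))) (sym w≡vni) (link C (next i)))
    ... | inj₁ (w≡vi , b≡vni) with j , nj≡i ← next-surjective i =
      j , (λ j≡i → w≢b (trans w≡vi (trans (cong (vs C) (trans (sym nj≡i) (cong next j≡i))) (sym b≡vni))))
      , at-w _ (vs C j) (es-in C j) (Joins-sym (subst (Joins G (es C j) (vs C j)) (trans (cong (vs C) nj≡i) (sym w≡vi)) (link C j)))

    replace-edge : ∀ {S'} m f → Joins G f (vs C m) (vs C (next m)) → (∀ j → es C j ≢ f)
      → neg G f ≡ neg G (es C m) → f ∈ S' → (∀ j → j ≢ m → es C j ∈ S')
      → NegativeCircuit G C → Σ (Circuit G S') (NegativeCircuit G)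
    replace-edge {S'} m f f-link f∉C sg f∈S' others negC =
      C' , sign⇒negative G C' (trans (parity-cong signs) (negative⇒sign G C negC))
      where
      es' : Fin (suc (len C)) → E
      es' j with j ≟ m
      ... | yes _ = f
      ... | no _  = es C j
      signs : ∀ j → neg G (es' j) ≡ neg G (es C j)
      signs j with j ≟ m
      ... | yes refl = sg
      ... | no _     = refl
      es'-inj : Injective _≡_ _≡_ es'
      es'-inj {i} {j} eq with i ≟ m | j ≟ m
      ... | yes i≡m | yes j≡m = trans i≡m (sym j≡m)
      ... | yes _   | no _    = void (f∉C j (sym eq))
      ... | no _    | yes _   = void (f∉C i eq)
      ... | no _    | no _    = es-inj C eq
      es'-in : ∀ j → es' j ∈ S'
      es'-in j with j ≟ m
      ... | yes _   = f∈S'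
      ... | no j≢m  = others j j≢m
      link' : ∀ j → Joins G (es' j) (vs C j) (vs C (next j))
      link' j with j ≟ m
      ... | yes refl = f-link
      ... | no _     = link C j
      C' : Circuit G S'
      C' = record { len = len C ; vs = vs C ; es = es' ; vs-inj = vs-inj C ; es-inj = es'-inj
                  ; es-in = es'-in ; link = link' }

module Walks (G : SGraph) (S : Subset (ne G)) where

  private
    V = Fin (nv G)
    E = Fin (ne G)

  data Walk : V → V → Set where
    nil  : ∀ {x} → Walk x x
    cons : ∀ {x y z} (e : E) → e ∈ S → Joins G e x y → Walk y z → Walk x z

  length : ∀ {x z} → Walk x z → ℕ
  length nil = 0
  length (cons _ _ _ W) = suc (length W)

  walkSign : ∀ {x z} → Walk x z → Bool
  walkSign nil = false
  walkSign (cons e _ _ W) = neg G e xor walkSign W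

  infixr 5 _++_
  _++_ : ∀ {x y z} → Walk x y → Walk y z → Walk x z
  nil ++ W' = W'
  cons e e∈ j W ++ W' = cons e e∈ j (W ++ W')

  walkSign-++ : ∀ {x y z} (W : Walk x y) (W' : Walk y z) → walkSign (W ++ W') ≡ walkSign W xor walkSign W'
  walkSign-++ nil W' = refl
  walkSign-++ (cons e _ _ W) W' =
    trans (cong (neg G e xor_) (walkSign-++ W W')) (sym (xor-assoc (neg G e) (walkSign W) (walkSign W')))

  length-++ : ∀ {x y z} (W : Walk x y) (W' : Walk y z) → length (W ++ W') ≡ length W + length W'
  length-++ nil W' = refl
  length-++ (cons _ _ _ W) W' = cong suc (length-++ W W')

  reverse : ∀ {x z} → Walk x z → Walk z x
  reverse nil = nil
  reverse (cons e e∈ j W) = reverse W ++ cons e e∈ (Joins-sym G j) nil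

  walkSign-reverse : ∀ {x z} (W : Walk x z) → walkSign (reverse W) ≡ walkSign W
  walkSign-reverse nil = refl
  walkSign-reverse (cons e e∈ j W) = begin
    walkSign (reverse W ++ cons e e∈ _ nil)  ≡⟨ walkSign-++ (reverse W) _ ⟩
    walkSign (reverse W) xor (neg G e xor false) ≡⟨ cong₂ _xor_ (walkSign-reverse W) (xor-identityʳ (neg G e)) ⟩
    walkSign W xor neg G e                   ≡⟨ xor-comm (walkSign W) (neg G e) ⟩
    neg G e xor walkSign W                   ∎
    where open ≡-Reasoning

  walkAlong : ∀ m (v : Fin (suc m) → V) (e : Fin m → E) → (∀ j → e j ∈ S)
    → (∀ j → Joins G (e j) (v (inject₁ j)) (v (suc j)))
    → Σ (Walk (v zero) (v (fromℕ m))) (λ W → walkSign W ≡ parity (neg G ∘ e))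
  walkAlong zero v e e∈ link = nil , refl
  walkAlong (suc m) v e e∈ link with W , sgn ← walkAlong m (v ∘ suc) (e ∘ suc) (e∈ ∘ suc) (link ∘ suc) =
    cons (e zero) (e∈ zero) (link zero) W , cong (neg G (e zero) xor_) sgn

  vertexAt : ∀ {x z} (W : Walk x z) → Fin (suc (length W)) → V
  vertexAt {x} W zero = x
  vertexAt (cons _ _ _ W) (suc i) = vertexAt W i

  edgeAt : ∀ {x z} (W : Walk x z) → Fin (length W) → E
  edgeAt (cons e _ _ W) zero = e
  edgeAt (cons _ _ _ W) (suc i) = edgeAt W i

  edgeAt-∈ : ∀ {x z} (W : Walk x z) i → edgeAt W i ∈ S
  edgeAt-∈ (cons _ e∈ _ W) zero = e∈
  edgeAt-∈ (cons _ _ _ W) (suc i) = edgeAt-∈ W i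

  edgeAt-joins : ∀ {x z} (W : Walk x z) i → Joins G (edgeAt W i) (vertexAt W (inject₁ i)) (vertexAt W (suc i))
  edgeAt-joins (cons _ _ j nil) zero = j
  edgeAt-joins (cons _ _ j (cons _ _ _ _)) zero = j
  edgeAt-joins (cons _ _ _ W) (suc i) = edgeAt-joins W i

  vertexAt-last : ∀ {x z} (W : Walk x z) → vertexAt W (fromℕ (length W)) ≡ z
  vertexAt-last nil = refl
  vertexAt-last (cons _ _ _ W) = vertexAt-last W

  walkSign≡parity : ∀ {x z} (W : Walk x z) → walkSign W ≡ parity (neg G ∘ edgeAt W)
  walkSign≡parity nil = refl
  walkSign≡parity (cons e _ _ W) = cong (neg G e xor_) (walkSign≡parity W)

  -- A walk is simple if all its vertices but the last are distinct.
  Simple : ∀ {x z} → Walk x z → Set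
  Simple nil = Unit
  Simple (cons {x} _ _ _ W) = (∀ i → x ≢ vertexAt W (inject₁ i)) × Simple W

  Simple-injective : ∀ {x z} (W : Walk x z) → Simple W → Injective _≡_ _≡_ (vertexAt W ∘ inject₁)
  Simple-injective (cons _ _ _ W) (new , simple) {zero}  {zero}  eq = refl
  Simple-injective (cons _ _ _ W) (new , simple) {zero}  {suc j} eq = void (new j eq)
  Simple-injective (cons _ _ _ W) (new , simple) {suc i} {zero}  eq = void (new i (sym eq))
  Simple-injective (cons _ _ _ W) (new , simple) {suc i} {suc j} eq = cong suc (Simple-injective W simple eq)

  simple-closed-walk⇒circuit : ∀ {x} (W : Walk x x) → Simple W → walkSign W ≡ true
    → Σ (Circuit G S) (NegativeCircuit G)
  simple-closed-walk⇒circuit nil _ ()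
  simple-closed-walk⇒circuit W@(cons _ _ _ W') simple odd = C , sign⇒negative G C sign≡true
    where
    l = length W'
    vs' : Fin (suc l) → V
    vs' = vertexAt W ∘ inject₁
    sign≡true : parity (neg G ∘ edgeAt W) ≡ true
    sign≡true = trans (sym (walkSign≡parity W)) odd
    link' : ∀ i → Joins G (edgeAt W i) (vs' i) (vs' (next i))
    link' i with lastOrInject₁ i
    ... | last rewrite next-fromℕ l = subst (Joins G _ (vs' (fromℕ l))) (vertexAt-last W) (edgeAt-joins W (fromℕ l))
    ... | inject j rewrite next-inject₁ j = edgeAt-joins W (inject₁ j)
    es-inj' : Injective _≡_ _≡_ (edgeAt W)
    es-inj' {i} {j} eq with i ≟ j
    ... | yes i≡j = i≡j
    ... | no i≢j = void (false≢true (trans (sym even) sign≡true))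
      where
      even = parallel-steps⇒parity-false G vs' (edgeAt W) (Simple-injective W simple) link' i≢j
               (link' i) (subst (λ c → Joins G c (vs' i) (vs' (next i))) eq (link' i)) (cong (neg G) eq)
    C : Circuit G S
    C = record { len = l ; vs = vs' ; es = edgeAt W ; vs-inj = Simple-injective W simple ; es-inj = es-inj'
               ; es-in = edgeAt-∈ W ; link = link' }

  cut : ∀ x {y z} (W : Walk y z)
    → (Σ (Walk y x) λ pre → Σ (Walk x z) λ post → pre ++ post ≡ W × 1 ≤ length post)
      ⊎ (∀ i → x ≢ vertexAt W (inject₁ i))
  cut x nil = inj₂ λ ()
  cut x (cons {y} e e∈ j W) with x ≟ y
  ... | yes refl = inj₁ (nil , cons e e∈ j W , refl , s≤s z≤n)
  ... | no x≢y with cut x W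
  ...   | inj₁ (pre , post , refl , post≥1) = inj₁ (cons e e∈ j pre , post , refl , post≥1)
  ...   | inj₂ x∉W = inj₂ λ { zero → x≢y ; (suc i) → x∉W i }

  record Shortcut {x z} (W : Walk x z) : Set where
    field
      {u}    : V
      loop   : Walk u u
      rest   : Walk x z
      loop<  : length loop < length W
      rest<  : length rest < length W
      sign≡  : walkSign loop xor walkSign rest ≡ walkSign W

  simpleOrShortcut : ∀ {x z} (W : Walk x z) → Simple W ⊎ Shortcut W
  simpleOrShortcut nil = inj₁ tt
  simpleOrShortcut (cons {x} e e∈ j W) with simpleOrShortcut W
  ... | inj₂ sc = inj₂ record
    { loop = loop ; rest = cons e e∈ j rest ; loop< = ≤-trans loop< (n≤1+n _) ; rest< = s≤s rest<
    ; sign≡ = trans (xor-swap (walkSign loop) (neg G e) (walkSign rest)) (cong (neg G e xor_) sign≡) }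
    where
    open Shortcut sc
    xor-swap : ∀ a b c → a xor (b xor c) ≡ b xor (a xor c)
    xor-swap a b c = trans (sym (xor-assoc a b c)) (trans (cong (_xor c) (xor-comm a b)) (xor-assoc b a c))
  ... | inj₁ simple with cut x W
  ...   | inj₂ x∉W = inj₁ (x∉W , simple)
  ...   | inj₁ (pre , post , refl , post≥1) = inj₂ record
    { loop = cons e e∈ j pre ; rest = post
    ; loop< = s≤s (≤-trans (≤-reflexive (+-comm 1 (length pre)))
                    (≤-trans (+-monoʳ-≤ (length pre) post≥1) (≤-reflexive (sym (length-++ pre post)))))
    ; rest< = s≤s (≤-trans (m≤n+m (length post) (length pre)) (≤-reflexive (sym (length-++ pre post))))
    ; sign≡ = trans (xor-assoc (neg G e) (walkSign pre) (walkSign post)) (cong (neg G e xor_) (sym (walkSign-++ pre post))) }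

  -- Cutting a closed walk at a repeated vertex splits its sign between two shorter closed
  -- walks, so one of them is again negative.
  odd-closed-walk⇒negative-circuit : ∀ {x} (W : Walk x x) → walkSign W ≡ true → Σ (Circuit G S) (NegativeCircuit G)
  odd-closed-walk⇒negative-circuit W = go (length W) W ≤-refl
    where
    go : ∀ n {x} (W : Walk x x) → length W ≤ n → walkSign W ≡ true → Σ (Circuit G S) (NegativeCircuit G)
    go n W _ odd with simpleOrShortcut W
    ... | inj₁ simple = simple-closed-walk⇒circuit W simple odd
    go zero W ≤0 odd | inj₂ sc = void (n≮0 (≤-trans (Shortcut.loop< sc) ≤0))
    go (suc n) W ≤n odd | inj₂ record { loop = loop ; rest = rest ; loop< = loop< ; rest< = rest< ; sign≡ = sign≡ }
      with walkSign loop in loop-sign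
    ... | true = go n loop (≤-pred (≤-trans loop< ≤n)) loop-sign
    ... | false = go n rest (≤-pred (≤-trans rest< ≤n)) (trans sign≡ odd)

  Walk-cast : ∀ {x x' y y'} → x ≡ x' → y ≡ y' → (W : Walk x y) → Σ (Walk x' y') λ W' → walkSign W' ≡ walkSign W
  Walk-cast refl refl W = W , refl

module _ (G : SGraph) {S : Subset (ne G)} where

  rotate : Circuit G S → Circuit G S
  rotate C = record
    { len = len C ; vs = vs C ∘ next ; es = es C ∘ next
    ; vs-inj = next-injective ∘ vs-inj C ; es-inj = next-injective ∘ es-inj C
    ; es-in = es-in C ∘ next ; link = link C ∘ next }

  rotate-to : ∀ n (C : Circuit G S) i → toℕ i ≡ n
    → Σ (Circuit G S) λ C' → sign G C' ≡ sign G C × es C' zero ≡ es C i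
  rotate-to _ C zero _ = C , refl , refl
  rotate-to (suc n) C (suc j) refl with C' , sgn , at0 ← rotate-to n (rotate C) (inject₁ j) (toℕ-inject₁ j) =
    C' , trans sgn (parity-∘next (neg G ∘ es C)) , trans at0 (cong (es C) (next-inject₁ j))

module _ (G : SGraph) {S : Subset (ne G)} where

  open Walks G S

  private
    xor≡true⇒≡not : ∀ a b → a xor b ≡ true → b ≡ not a
    xor≡true⇒≡not false b eq = eq
    xor≡true⇒≡not true false _ = refl
    xor≡true⇒≡not true true ()

  circuit-through : ∀ {S' p} → Balanced G S → (∀ {c} → c ∈ S' → c ≢ p → c ∈ S)
    → Σ (Circuit G S') (NegativeCircuit G) → Σ (Circuit G S') λ D → sign G D ≡ true × es D zero ≡ p
  circuit-through {p = p} bal S'⊆S+p (C , negC) with any? (λ i → es C i ≟ p)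
  ... | no p∉C = void (bal (restrict G C (λ i → S'⊆S+p (es-in C i) (λ eq → p∉C (i , eq))) , negC))
  ... | yes (i , Ci≡p) with D , sgn , D0≡Ci ← rotate-to G (toℕ i) C i refl =
    D , trans sgn (negative⇒sign G C negC) , trans D0≡Ci Ci≡p

  circuit-tail : ∀ {S'} (D : Circuit G S') → (∀ j → es D (suc j) ∈ S)
    → Σ (Walk (vs D (next zero)) (vs D zero)) λ W → walkSign W ≡ parity (neg G ∘ es D ∘ suc)
  circuit-tail D tail∈S =
    let W , W-sign = walkAlong (len D) (vs D ∘ next) (es D ∘ suc) tail∈S tail-link
        W' , W'-sign = Walk-cast refl (cong (vs D) (next-fromℕ (len D))) W
    in W' , trans W'-sign W-sign
    where
    tail-link : ∀ j → Joins G (es D (suc j)) (vs D (next (inject₁ j))) (vs D (next (suc j)))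
    tail-link j rewrite next-inject₁ j = link D (suc j)

  orient : ∀ {a b u v s} → (a ≡ u × b ≡ v) ⊎ (a ≡ v × b ≡ u)
    → (W : Walk b a) → walkSign W ≡ s → Σ (Walk u v) λ W' → walkSign W' ≡ s
  orient (inj₁ (a≡u , b≡v)) W W-sign =
    let W' , W'-sign = Walk-cast a≡u b≡v (reverse W)
    in W' , trans W'-sign (trans (walkSign-reverse W) W-sign)
  orient (inj₂ (a≡v , b≡u)) W W-sign =
    let W' , W'-sign = Walk-cast b≡u a≡v W
    in W' , trans W'-sign W-sign

  detour : ∀ {S' p u v} → Balanced G S → (∀ {c} → c ∈ S' → c ≢ p → c ∈ S) → Joins G p u v
    → Σ (Circuit G S') (NegativeCircuit G) → Σ (Walk u v) λ W → walkSign W ≡ not (neg G p)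
  detour {p = p} bal S'⊆S+p p-uv negC =
    let D , D-sign , D0≡p = circuit-through bal S'⊆S+p negC
        W , W-sign = circuit-tail D (λ j → S'⊆S+p (es-in D (suc j)) (zero≢suc ∘ es-inj D ∘ trans D0≡p ∘ sym))
        tail = parity (neg G ∘ es D ∘ suc)
    in orient (Joins-unique G (subst (λ c → Joins G c (vs D zero) (vs D (next zero))) D0≡p (link D zero)) p-uv) W
         (trans W-sign (xor≡true⇒≡not (neg G p) tail (trans (cong (λ c → neg G c xor tail) (sym D0≡p)) D-sign)))
    where
    zero≢suc : ∀ {n} {k : Fin n} → Fin.zero ≢ suc k
    zero≢suc ()

  -- The two detours close up to a negative closed walk in S.
  opposite-parallel-edges : ∀ {S₁ S₂ p n u v} → Balanced G S → Joins G p u v → Joins G n u v → neg G n ≡ not (neg G p)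
    → (∀ {c} → c ∈ S₁ → c ≢ p → c ∈ S) → (∀ {c} → c ∈ S₂ → c ≢ n → c ∈ S)
    → Σ (Circuit G S₁) (NegativeCircuit G) → Σ (Circuit G S₂) (NegativeCircuit G) → Void
  opposite-parallel-edges {p = p} {n} bal p-uv n-uv opposite S₁⊆S+p S₂⊆S+n negC₁ negC₂ =
    let Wp , Wp-sign = detour bal S₁⊆S+p p-uv negC₁
        Wn , Wn-sign = detour bal S₂⊆S+n n-uv negC₂
        odd = begin
          walkSign (Wp ++ reverse Wn)              ≡⟨ walkSign-++ Wp (reverse Wn) ⟩
          walkSign Wp xor walkSign (reverse Wn)    ≡⟨ cong₂ _xor_ Wp-sign (trans (walkSign-reverse Wn) Wn-sign) ⟩
          not (neg G p) xor not (neg G n)          ≡⟨ cong (λ b → not (neg G p) xor not b) opposite ⟩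
          not (neg G p) xor not (not (neg G p))    ≡⟨ not-xor-not-not (neg G p) ⟩
          true                                     ∎
    in bal (odd-closed-walk⇒negative-circuit (Wp ++ reverse Wn) odd)
    where
    open ≡-Reasoning
    not-xor-not-not : ∀ a → not a xor not (not a) ≡ true
    not-xor-not-not true = refl
    not-xor-not-not false = refl

-- Balancedness is not decidable here, so minimal subgraphs are found in the double-negation
-- monad; this suffices because they are only used to derive a contradiction.
module _ where
  open RawMonad (¬¬-Monad {a = 0ℓ})

  ¬¬-∀Fin : ∀ {n} {P : Fin n → Set} → (∀ x → ¬ ¬ P x) → ¬ ¬ (∀ x → P x)
  ¬¬-∀Fin {zero} _ = return λ ()
  ¬¬-∀Fin {suc n} {P} ¬¬P = do
    P0 ← ¬¬P zero
    Psuc ← ¬¬-∀Fin (¬¬P ∘ suc)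
    return λ { zero → P0 ; (suc x) → Psuc x }

  ¬¬-least : (P : ℕ → Set) → ∀ {s} → P s → ¬ ¬ (Σ ℕ λ j → P j × (∀ i → P i → j ≤ i))
  ¬¬-least P {s} Ps = go s ≤-refl Ps
    where
    go : ∀ n {s} → s ≤ n → P s → ¬ ¬ (Σ ℕ λ j → P j × (∀ i → P i → j ≤ i))
    go zero {s} s≤0 Ps = return (s , Ps , λ _ _ → ≤-trans s≤0 z≤n)
    go (suc n) {s} s≤n Ps = do
      yes (i , i<s , Pi) ← ¬¬-excluded-middle {A = Σ ℕ λ i → i < s × P i}
        where no none → return (s , Ps , λ i Pi → ≮⇒≥ (λ i<s → none (i , i<s , Pi)))
      go n (≤-pred (≤-trans i<s s≤n)) Pi

  module _ (G : SGraph) where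

    FrustrationAtLeast : Subset (ne G) → ℕ → Set
    FrustrationAtLeast T m = ∀ F → F ⊆ T → Balanced G (T ─ F) → m ≤ ∣ F ∣

    ¬FrustrationAtLeast : ∀ {T m} → ¬ FrustrationAtLeast T m
      → ¬ ¬ (Σ (Subset (ne G)) λ F → F ⊆ T × Balanced G (T ─ F) × ∣ F ∣ < m)
    ¬FrustrationAtLeast ¬fal ¬small = ¬fal λ F F⊆T bal → ≮⇒≥ λ ∣F∣<m → ¬small (F , F⊆T , bal , ∣F∣<m)

    frustrationIndex-exists : ∀ {T F} → F ⊆ T → Balanced G (T ─ F)
      → ¬ ¬ (∃[ j ] (j ≤ ∣ F ∣ × FrustrationIndex G T j))
    frustrationIndex-exists {T} {F} F⊆T bal = do
      j , (F' , F'⊆T , ∣F'∣≡j , bal') , least ← ¬¬-least Balancing (F , (λ {x} → F⊆T {x}) , refl , bal)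
      return (j , least ∣ F ∣ (F , (λ {x} → F⊆T {x}) , refl , bal) , (F' , (λ {x} → F'⊆T {x}) , ∣F'∣≡j , bal')
             , λ F'' F''⊆T bal'' → least ∣ F'' ∣ (F'' , (λ {x} → F''⊆T {x}) , refl , bal''))
      where
      Balancing : ℕ → Set
      Balancing i = ∃[ F ] (F ⊆ T × ∣ F ∣ ≡ i × Balanced G (T ─ F))

    MinimalAtLeast : Subset (ne G) → ℕ → Set
    MinimalAtLeast T m = FrustrationAtLeast T m × (∀ e → e ∈ T → ¬ FrustrationAtLeast (T - e) m)

    ¬¬-minimal : ∀ n {T m} → ∣ T ∣ ≤ n → FrustrationAtLeast T m
      → ¬ ¬ (Σ (Subset (ne G)) λ T' → T' ⊆ T × MinimalAtLeast T' m)
    ¬¬-minimal n {T} {m} ∣T∣≤n fal = do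
      yes (e , e∈T , fal-e) ← ¬¬-excluded-middle {A = Σ (Fin (ne G)) λ e → e ∈ T × FrustrationAtLeast (T - e) m}
        where no none → return (T , (λ {x} x∈T → x∈T) , fal , λ e e∈T fal-e → none (e , e∈T , fal-e))
      shrink n ∣T∣≤n e∈T fal-e
      where
      shrink : ∀ n {e} → ∣ T ∣ ≤ n → e ∈ T → FrustrationAtLeast (T - e) m
        → ¬ ¬ (Σ (Subset (ne G)) λ T' → T' ⊆ T × MinimalAtLeast T' m)
      shrink zero    ∣T∣≤0 e∈T _ = void (n≮0 (≤-trans (x∈p⇒∣p-x∣<∣p∣ e∈T) ∣T∣≤0))
      shrink (suc n) ∣T∣≤n e∈T fal-e = do
        T' , T'⊆T-e , minimal ← ¬¬-minimal n (≤-pred (≤-trans (x∈p⇒∣p-x∣<∣p∣ e∈T) ∣T∣≤n)) fal-e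
        return (T' , (λ {x} x∈T' → p─q⊆p T ⁅ _ ⁆ (T'⊆T-e x∈T')) , minimal)

    Balanced-∅ : ∀ {S} → Empty S → Balanced G S
    Balanced-∅ empty (C , _) = empty (es C zero , es-in C zero)

    Balanced-─∪ : ∀ T X F → Balanced G ((T ─ X) ─ F) → Balanced G (T ─ (X ∪ F))
    Balanced-─∪ T X F = subst (Balanced G) (p─q─r≡p─q∪r T X F)

    minimal⇒deletion : ∀ {T m} → MinimalAtLeast T m → ∀ e
      → ¬ ¬ (e ∈ T → ∃[ j ] (j < m × FrustrationIndex G (T - e) j))
    minimal⇒deletion {T} (_ , minimal) e with e ∈? T
    ... | no e∉T = return λ e∈T → void (e∉T e∈T)
    ... | yes e∈T = do
      F , F⊆T-e , bal , ∣F∣<m ← ¬FrustrationAtLeast (minimal e e∈T)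
      j , j≤∣F∣ , index ← frustrationIndex-exists F⊆T-e bal
      return λ _ → j , ≤-trans (s≤s j≤∣F∣) ∣F∣<m , index

    frustrationIndex-via-deletion : ∀ {T m e F} → e ∈ T → FrustrationAtLeast T m
      → F ⊆ T - e → Balanced G ((T - e) ─ F) → ∣ F ∣ < m → FrustrationIndex G T m
    frustrationIndex-via-deletion {T} {m} {e} {F} e∈T fal F⊆T-e bal ∣F∣<m =
      (⁅ e ⁆ ∪ F , F'⊆T , ≤-antisym ∣F'∣≤m (fal _ F'⊆T bal') , bal') , fal
      where
      F'⊆T : ⁅ e ⁆ ∪ F ⊆ T
      F'⊆T = ∪-⊆ (⁅x⁆⊆p e∈T) (p─q⊆p T ⁅ e ⁆ ∘ F⊆T-e)
      bal' = Balanced-─∪ T ⁅ e ⁆ F bal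
      ∣F'∣≤m = ≤-trans (∣p∪q∣≤∣p∣+∣q∣ ⁅ e ⁆ F) (subst (λ c → c + ∣ F ∣ ≤ m) (sym (∣⁅x⁆∣≡1 e)) ∣F∣<m)

    minimal⇒critical : ∀ {T m} → 1 ≤ m → MinimalAtLeast T m → ¬ ¬ Critical G T m
    minimal⇒critical {T} {m} m≥1 (fal , minimal) with nonempty? T
    ... | no empty = void (n≮0 (≤-trans m≥1 (≤-trans (fal ⊥ (λ x∈⊥ → void (∉⊥ x∈⊥)) bal) (≤-reflexive (∣⊥∣≡0 (ne G))))))
      where bal = Balanced-∅ λ (x , x∈T─⊥) → empty (x , p─q⊆p T ⊥ x∈T─⊥)
    ... | yes (e , e∈T) = do
      F , F⊆T-e , bal , ∣F∣<m ← ¬FrustrationAtLeast (minimal e e∈T)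
      deletions ← ¬¬-∀Fin (minimal⇒deletion (fal , minimal))
      return (frustrationIndex-via-deletion e∈T fal (λ {x} → F⊆T-e {x}) bal ∣F∣<m , deletions)

    critical-subgraph : ∀ {T m} → 1 ≤ m → FrustrationAtLeast T m
      → ¬ ¬ (Σ (Subset (ne G)) λ T' → T' ⊆ T × Critical G T' m)
    critical-subgraph {T} m≥1 fal = do
      T' , T'⊆T , minimal ← ¬¬-minimal ∣ T ∣ ≤-refl fal
      critical ← minimal⇒critical m≥1 minimal
      return (T' , (λ {x} → T'⊆T {x}) , critical)

    ¬¬-decomposable : ∀ {k'} → 1 ≤ k' → ∀ D → FrustrationAtLeast D 1 → FrustrationAtLeast (⊤ ─ D) k'
      → ¬ ¬ Decomposable G (suc k')
    ¬¬-decomposable {k'} k'≥1 D fal-D fal-rest = do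
      T₁ , T₁⊆D , critical₁ ← critical-subgraph (s≤s z≤n) fal-D
      T₂ , T₂⊆rest , critical₂ ← critical-subgraph k'≥1 fal-rest
      let disjoint : Empty (T₁ ∩ T₂)
          disjoint (x , x∈T₁∩T₂) = let x∈T₁ , x∈T₂ = x∈p∩q⁻ T₁ T₂ x∈T₁∩T₂
                                   in x∈p─q⇒x∉q ⊤ D (T₂⊆rest x∈T₂) (T₁⊆D x∈T₁)
      return ((1 , T₁) ∷ (k' , T₂) ∷ [] , s≤s (s≤s z≤n) , (s≤s z≤n , critical₁) ∷ (k'≥1 , critical₂) ∷ []
             , cong suc (+-identityʳ k') , (disjoint ∷ []) ∷ [] ∷ [])

    negative⇒FrustrationAtLeast1 : ∀ {D} → Σ (Circuit G D) (NegativeCircuit G) → FrustrationAtLeast D 1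
    negative⇒FrustrationAtLeast1 (C , negC) F _ bal with ∣ F ∣ in ∣F∣≡
    ... | suc _ = s≤s z≤n
    ... | zero = void (bal (restrict G C (λ i → x∈p∧x∉q⇒x∈p─q (es-in C i) (∣p∣≡0⇒x∉p ∣F∣≡)) , negC))

module _ (G : SGraph) where

  -- f takes over the role of e in any negative circuit.
  Balanced-parallel-copy : ∀ {E e f x y} → Balanced G ((⊤ - e) ─ E) → f ∉ E → f ≢ e
    → Joins G e x y → Joins G f x y → neg G f ≡ neg G e → Balanced G (⊤ ─ E)
  Balanced-parallel-copy {E} {e} {f} bal f∉E f≢e e-xy f-xy sg (C , negC) with any? (λ i → es C i ≟ e)
  ... | no e∉C = bal (restrict G C (λ i → x∈p∧x∉q⇒x∈p─q (x∈p∧x≢y⇒x∈p-y ∈⊤ (λ eq → e∉C (i , eq)))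
                                        (x∈p─q⇒x∉q ⊤ E (es-in C i))) , negC)
  ... | yes (m , Cm≡e) with any? (λ i → es C i ≟ f)
  ...   | yes (m' , Cm'≡f) =
    parallel-edges⇒positive G C (λ m'≡m → f≢e (trans (sym Cm'≡f) (trans (cong (es C) m'≡m) Cm≡e)))
      (subst (λ c → Joins G c _ _) (sym Cm'≡f) f-xy) (subst (λ c → Joins G c _ _) (sym Cm≡e) e-xy)
      (trans (cong (neg G) Cm'≡f) (trans sg (cong (neg G) (sym Cm≡e)))) negC
  ...   | no f∉C = bal (replace-edge G C m f f-link (λ i eq → f∉C (i , eq)) (trans sg (cong (neg G) (sym Cm≡e)))
                          (x∈p∧x∉q⇒x∈p─q (x∈p∧x≢y⇒x∈p-y ∈⊤ f≢e) f∉E) others negC)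
    where
    f-link : Joins G f (vs C m) (vs C (next m))
    f-link = Joins-parallel G f-xy e-xy (subst (λ c → Joins G c _ _) Cm≡e (link C m))
    others : ∀ i → i ≢ m → es C i ∈ (⊤ - e) ─ E
    others i i≢m = x∈p∧x∉q⇒x∈p─q (x∈p∧x≢y⇒x∈p-y ∈⊤ (λ eq → i≢m (es-inj C (trans eq (sym Cm≡e)))))
                     (x∈p─q⇒x∉q ⊤ E (es-in C i))

  negative-circuit-avoids : ∀ {S w y} → w ≢ y → (∀ c u → c ∈ S → Joins G c w u → Joins G c w y)
    → (∀ p n → Joins G p w y → Joins G n w y → neg G p ≡ neg G n)
    → (C : Circuit G S) → NegativeCircuit G C → ∀ i → ¬ Joins G (es C i) w y
  negative-circuit-avoids w≢y at-w same-sign C negC i i-wy =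
    let m , m≢i , m-wy = another-edge-at G C w≢y at-w i i-wy
    in parallel-edges⇒positive G C m≢i m-wy i-wy (same-sign _ _ m-wy i-wy) negC

  Balanced-positive-loop : ∀ {F ℓ u} → ends G ℓ ≡ (u , u) → neg G ℓ ≡ false
    → Balanced G ((⊤ - ℓ) ─ F) → Balanced G (⊤ ─ F)
  Balanced-positive-loop {F} {ℓ} loop positive bal (C , negC) with any? (λ i → es C i ≟ ℓ)
  ... | yes (i , Ci≡ℓ) = positive-loop⇒positive G C i (trans (cong (ends G) Ci≡ℓ) loop) (trans (cong (neg G) Ci≡ℓ) positive) negC
  ... | no ℓ∉C = bal (restrict G C (λ i → x∈p∧x∉q⇒x∈p─q (x∈p∧x≢y⇒x∈p-y ∈⊤ (λ eq → ℓ∉C (i , eq)))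
                                        (x∈p─q⇒x∉q ⊤ F (es-in C i))) , negC)

  negative-loop : ∀ ℓ {u} → ends G ℓ ≡ (u , u) → neg G ℓ ≡ true → Σ (Circuit G ⁅ ℓ ⁆) (NegativeCircuit G)
  negative-loop ℓ {u} loop negative = C , sign⇒negative G C (cong (_xor false) negative)
    where
    C : Circuit G ⁅ ℓ ⁆
    C = record { len = 0 ; vs = λ _ → u ; es = λ _ → ℓ ; vs-inj = λ { {zero} {zero} _ → refl }
               ; es-inj = λ { {zero} {zero} _ → refl } ; es-in = λ { zero → x∈⁅x⁆ ℓ } ; link = λ { zero → inj₁ loop } }

  negative-digon : ∀ {p n u v} → u ≢ v → Joins G p u v → Joins G n v u → neg G n ≡ not (neg G p)
    → Σ (Circuit G (⁅ p ⁆ ∪ ⁅ n ⁆)) (NegativeCircuit G)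
  negative-digon {p} {n} {u} {v} u≢v p-uv n-vu opposite = C , sign⇒negative G C (odd (neg G p) (neg G n) opposite)
    where
    odd : ∀ a b → b ≡ not a → a xor (b xor false) ≡ true
    odd true  false _ = refl
    odd false true  _ = refl
    p≢n : p ≢ n
    p≢n refl = not-¬ refl opposite
    vs' : Fin 2 → Fin (nv G)
    vs' zero = u
    vs' (suc zero) = v
    es' : Fin 2 → Fin (ne G)
    es' zero = p
    es' (suc zero) = n
    pair-injective : ∀ {A : Set} (f : Fin 2 → A) → f zero ≢ f (suc zero) → Injective _≡_ _≡_ f
    pair-injective f f0≢f1 {zero}     {zero}     _ = refl
    pair-injective f f0≢f1 {zero}     {suc zero} eq = void (f0≢f1 eq)
    pair-injective f f0≢f1 {suc zero} {zero}     eq = void (f0≢f1 (sym eq))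
    pair-injective f f0≢f1 {suc zero} {suc zero} _ = refl
    C : Circuit G (⁅ p ⁆ ∪ ⁅ n ⁆)
    C = record
      { len = 1 ; vs = vs' ; es = es'
      ; vs-inj = pair-injective vs' u≢v ; es-inj = pair-injective es' p≢n
      ; es-in = λ { zero → x∈p∪q⁺ (inj₁ (x∈⁅x⁆ p)) ; (suc zero) → x∈p∪q⁺ (inj₂ (x∈⁅x⁆ n)) }
      ; link = λ { zero → p-uv ; (suc zero) → n-vu } }

  edgesBetween : Fin (nv G) → Fin (nv G) → Subset (ne G)
  edgesBetween x y = tabulate λ e → isYes (Joins? G e x y)

  ∈edgesBetween⁻ : ∀ {e x y} → e ∈ edgesBetween x y → Joins G e x y
  ∈edgesBetween⁻ {e} {x} {y} e∈ = from-isYes (Joins? G e x y) (trans (sym (lookup∘tabulate _ e)) ([]=⇒lookup e∈))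
    where from-isYes : ∀ {P : Set} (d : Dec P) → isYes d ≡ true → P
          from-isYes (yes p) _ = p

  ∈edgesBetween⁺ : ∀ {e x y} → Joins G e x y → e ∈ edgesBetween x y
  ∈edgesBetween⁺ {e} {x} {y} e-xy = lookup⇒[]= e _ (trans (lookup∘tabulate _ e) (isYes-yes (Joins? G e x y)))
    where isYes-yes : (d : Dec (Joins G e x y)) → isYes d ≡ true
          isYes-yes (yes _) = refl
          isYes-yes (no ¬e-xy) = void (¬e-xy e-xy)

  Balanced-trade-multiedge : ∀ {w x y F} → w ≢ y → (∀ e u → Joins G e w u → Joins G e w x ⊎ Joins G e w y)
    → (∀ p n → Joins G p w y → Joins G n w y → neg G p ≡ neg G n)
    → edgesBetween w y ⊆ F → Balanced G (⊤ ─ F)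
    → Balanced G (⊤ ─ ((F ─ edgesBetween w y) ∪ edgesBetween w x))
  Balanced-trade-multiedge {w} {x} {y} {F} w≢y at-w same-sign Y⊆F bal (C , negC)
    with any? (λ i → es C i ∈? edgesBetween w y)
  ... | yes (i , Ci∈Y) = negative-circuit-avoids w≢y at-w' same-sign C negC i (∈edgesBetween⁻ Ci∈Y)
    where
    at-w' : ∀ c u → c ∈ ⊤ ─ ((F ─ edgesBetween w y) ∪ edgesBetween w x) → Joins G c w u → Joins G c w y
    at-w' c u c∈ c-wu with at-w c u c-wu
    ... | inj₁ c-wx = void (x∈p─q⇒x∉q ⊤ _ c∈ (x∈p∪q⁺ (inj₂ (∈edgesBetween⁺ c-wx))))
    ... | inj₂ c-wy = c-wy
  ... | no Y∉C = bal (restrict G C avoids-F , negC)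
    where
    avoids-F : ∀ i → es C i ∈ ⊤ ─ F
    avoids-F i = x∈p∧x∉q⇒x∈p─q ∈⊤ λ Ci∈F →
      x∈p─q⇒x∉q ⊤ _ (es-in C i) (x∈p∪q⁺ (inj₁ (x∈p∧x∉q⇒x∈p─q Ci∈F (λ Ci∈Y → Y∉C (i , Ci∈Y)))))

module CriticalGraph (G : SGraph) {k} (critical : Critical G ⊤ k) where

  lower-bound : ∀ F → Balanced G (⊤ ─ F) → k ≤ ∣ F ∣
  lower-bound F = proj₂ (proj₁ critical) F (λ _ → ∈⊤)

  lower-bound-∪ : ∀ X F → Balanced G ((⊤ ─ X) ─ F) → k ≤ ∣ X ∣ + ∣ F ∣
  lower-bound-∪ X F bal = ≤-trans (lower-bound (X ∪ F) (Balanced-─∪ G ⊤ X F bal)) (∣p∪q∣≤∣p∣+∣q∣ X F)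

  lower-bound-deletion : ∀ e F → Balanced G ((⊤ - e) ─ F) → k ≤ suc ∣ F ∣
  lower-bound-deletion e F bal = subst (λ c → k ≤ c + ∣ F ∣) (∣⁅x⁆∣≡1 e) (lower-bound-∪ ⁅ e ⁆ F bal)

  deletion : ∀ e → ∃[ j ] (j < k × FrustrationIndex G (⊤ - e) j)
  deletion e = proj₂ critical e ∈⊤

  no-positive-loop : ∀ ℓ {u} → ends G ℓ ≡ (u , u) → neg G ℓ ≢ false
  no-positive-loop ℓ loop positive =
    let j , j<k , (F , _ , ∣F∣≡j , bal) , _ = deletion ℓ
    in <-irrefl refl (≤-trans j<k (subst (k ≤_) ∣F∣≡j (lower-bound F (Balanced-positive-loop G loop positive bal))))

  -- Let E balance G − e for a w–y edge e. If E misses another w–y edge, E balances G;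
  -- otherwise trading the w–y edges of E + e for the w–x edges balances G with fewer than k edges.
  multiplicity-bound : ∀ {w x y} → w ≢ y → (∀ e u → Joins G e w u → Joins G e w x ⊎ Joins G e w y)
    → (∀ p n → Joins G p w y → Joins G n w y → neg G p ≡ neg G n)
    → ∣ edgesBetween G w y ∣ ≤ ∣ edgesBetween G w x ∣
  multiplicity-bound {w} {x} {y} w≢y at-w same-sign = ≮⇒≥ λ ∣X∣<∣Y∣ →
    let e , e∈Y = ∣p∣>0⇒Nonempty Y (≤-trans (s≤s z≤n) ∣X∣<∣Y∣)
        j , j<k , (E , _ , ∣E∣≡j , bal) , _ = deletion e
        F = ⁅ e ⁆ ∪ E
    in case any? (λ f → (f ∈? Y) ×-dec ¬? (f ∈? F)) of λ where
      (yes (f , f∈Y , f∉F)) →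
        <-irrefl refl (≤-trans j<k (subst (k ≤_) ∣E∣≡j (lower-bound E
          (Balanced-parallel-copy G bal (f∉F ∘ x∈p∪q⁺ ∘ inj₂) (x∉⁅y⁆⇒x≢y (f∉F ∘ x∈p∪q⁺ ∘ inj₁))
            (∈edgesBetween⁻ G e∈Y) (∈edgesBetween⁻ G f∈Y) (same-sign _ _ (∈edgesBetween⁻ G f∈Y) (∈edgesBetween⁻ G e∈Y))))))
      (no none) →
        let Y⊆F : Y ⊆ F
            Y⊆F {f} f∈Y = decidable-stable (f ∈? F) (λ f∉F → none (f , f∈Y , f∉F))
            traded = (F ─ Y) ∪ X
        in <-irrefl refl (begin-strict
          k                      ≤⟨ lower-bound traded (Balanced-trade-multiedge G w≢y at-w same-sign Y⊆F (Balanced-─∪ G ⊤ ⁅ e ⁆ E bal)) ⟩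
          ∣ traded ∣             ≤⟨ ∣p∪q∣≤∣p∣+∣q∣ (F ─ Y) X ⟩
          ∣ F ─ Y ∣ + ∣ X ∣      <⟨ +-monoʳ-< ∣ F ─ Y ∣ ∣X∣<∣Y∣ ⟩
          ∣ F ─ Y ∣ + ∣ Y ∣      ≤⟨ ∣p─q∣+∣q∣≤∣p∣ Y⊆F ⟩
          ∣ F ∣                  ≤⟨ ∣p∪q∣≤∣p∣+∣q∣ ⁅ e ⁆ E ⟩
          ∣ ⁅ e ⁆ ∣ + ∣ E ∣      ≡⟨ cong₂ _+_ (∣⁅x⁆∣≡1 e) ∣E∣≡j ⟩
          suc j                  ≤⟨ j<k ⟩
          k                      ∎)
    where
    open ≤-Reasoning
    X = edgesBetween G w x
    Y = edgesBetween G w y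

-- For k = 1, deleting q leaves the negative circuit of D, although G − q is balanced;
-- for k > 1, D and the rest of G contain a decomposition.
no-negative-split : ∀ {G k} → 1 ≤ k → Critical G ⊤ k → ¬ Decomposable G k
  → ∀ D q → q ∉ D → Σ (Circuit G D) (NegativeCircuit G)
  → (∀ F → F ⊆ ⊤ ─ D → Balanced G ((⊤ ─ D) ─ F) → k ≤ suc ∣ F ∣) → Void
no-negative-split {G} {suc zero} _ critical _ D q q∉D (C , negC) _ with CriticalGraph.deletion G critical q
... | zero , _ , (F , _ , ∣F∣≡0 , bal) , _ =
  bal (restrict G C (λ i → x∈p∧x∉q⇒x∈p─q (x∈p∧x≢y⇒x∈p-y ∈⊤ (λ { refl → q∉D (es-in C i) })) (∣p∣≡0⇒x∉p ∣F∣≡0)) , negC)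
... | suc _ , s≤s () , _
no-negative-split {G} {suc (suc k')} _ _ indecomposable D _ _ negC lower-bound =
  ¬¬-decomposable G (s≤s z≤n) D (negative⇒FrustrationAtLeast1 G negC)
    (λ F F⊆ bal → ≤-pred (lower-bound F F⊆ bal)) indecomposable

module TwoNeighbours (G : SGraph) {k} (k≥1 : 1 ≤ k) (critical : Critical G ⊤ k) (indecomposable : ¬ Decomposable G k)
  {w a b} (a≢b : a ≢ b) (a≢w : a ≢ w) (b≢w : b ≢ w) (adj-a : Adjacent G w a) (adj-b : Adjacent G w b)
  (only : ∀ u → u ≢ w → Adjacent G w u → u ≡ a ⊎ u ≡ b) where

  open CriticalGraph G critical

  no-loop-at : ∀ ℓ → ends G ℓ ≢ (w , w)
  no-loop-at ℓ loop with neg G ℓ in sg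
  ... | false = no-positive-loop ℓ loop sg
  ... | true = no-negative-split k≥1 critical indecomposable ⁅ ℓ ⁆ (proj₁ adj-a) wa∉⁅ℓ⁆ (negative-loop G ℓ loop sg)
                 (λ F _ → lower-bound-deletion ℓ F)
    where
    wa∉⁅ℓ⁆ : proj₁ adj-a ∉ ⁅ ℓ ⁆
    wa∉⁅ℓ⁆ wa∈⁅ℓ⁆ with x∈⁅y⁆⇒x≡y ℓ wa∈⁅ℓ⁆
    ... | refl with Joins-unique G (proj₂ adj-a) (inj₁ loop)
    ...   | inj₁ (_ , a≡w) = a≢w a≡w
    ...   | inj₂ (_ , a≡w) = a≢w a≡w

  at-w : ∀ e u → Joins G e w u → Joins G e w a ⊎ Joins G e w b
  at-w e u e-wu with u ≟ w
  ... | yes refl = void (no-loop-at e (loop e-wu))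
    where loop : Joins G e w w → ends G e ≡ (w , w)
          loop (inj₁ p) = p
          loop (inj₂ p) = p
  ... | no u≢w with only u u≢w (e , e-wu)
  ...   | inj₁ refl = inj₁ e-wu
  ...   | inj₂ refl = inj₂ e-wu

  same-sign-towards : ∀ {x y} → x ≢ w → x ≢ y → Adjacent G w y
    → ∀ p n → Joins G p w x → Joins G n w x → neg G p ≡ neg G n
  same-sign-towards {x} {y} x≢w x≢y (q , q-wy) p n p-wx n-wx with neg G p ≟ᵇ neg G n
  ... | yes same = same
  ... | no differ = void (no-negative-split k≥1 critical indecomposable D q q∉D
                            (negative-digon G (x≢w ∘ sym) p-wx (Joins-sym G n-wx) opposite) lower-bound-rest)
    where
    D = ⁅ p ⁆ ∪ ⁅ n ⁆
    opposite : neg G n ≡ not (neg G p)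
    opposite = ¬-not (differ ∘ sym)
    not-wx : ∀ {c} → Joins G c w x → c ≢ q
    not-wx c-wx refl with Joins-unique G c-wx q-wy
    ... | inj₁ (_ , x≡y) = x≢y x≡y
    ... | inj₂ (_ , x≡w) = x≢w x≡w
    q∉D : q ∉ D
    q∉D q∈D with x∈p∪q⁻ ⁅ p ⁆ ⁅ n ⁆ q∈D
    ... | inj₁ q∈⁅p⁆ = not-wx p-wx (sym (x∈⁅y⁆⇒x≡y p q∈⁅p⁆))
    ... | inj₂ q∈⁅n⁆ = not-wx n-wx (sym (x∈⁅y⁆⇒x≡y n q∈⁅n⁆))
    -- If neither F + n nor F + p balanced G, the parallel edges p and n of opposite signs
    -- would both close negative circuits over the balanced G − D − F.
    lower-bound-rest : ∀ F → F ⊆ ⊤ ─ D → Balanced G ((⊤ ─ D) ─ F) → k ≤ suc ∣ F ∣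
    lower-bound-rest F _ bal = decidable-stable (k ≤? suc ∣ F ∣) λ k≰ →
      let unbalanced : ∀ e → ¬ Balanced G ((⊤ - e) ─ F)
          unbalanced e bal-e = k≰ (lower-bound-deletion e F bal-e)
      in unbalanced n λ negC-p → unbalanced p λ negC-n →
           opposite-parallel-edges G bal p-wx n-wx opposite
             (λ c∈ c≢p → let c∉F , c≢n = outside n c∈ in avoid c∉F c≢p c≢n)
             (λ c∈ c≢n → let c∉F , c≢p = outside p c∈ in avoid c∉F c≢p c≢n) negC-p negC-n
      where
      outside : ∀ e {c} → c ∈ (⊤ - e) ─ F → c ∉ F × c ≢ e
      outside e c∈ = x∈p─q⇒x∉q _ F c∈ , x∈p-y⇒x≢y ⊤ (p─q⊆p _ F c∈)
      avoid : ∀ {c} → c ∉ F → c ≢ p → c ≢ n → c ∈ (⊤ ─ D) ─ F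
      avoid c∉F c≢p c≢n = x∈p∧x∉q⇒x∈p─q (x∈p∧x∉q⇒x∈p─q ∈⊤ λ c∈D →
        [ c≢p ∘ x∈⁅y⁆⇒x≡y p , c≢n ∘ x∈⁅y⁆⇒x≡y n ]′ (x∈p∪q⁻ ⁅ p ⁆ ⁅ n ⁆ c∈D)) c∉F

  sign-towards-a : ∀ p n → Joins G p w a → Joins G n w a → neg G p ≡ neg G n
  sign-towards-a = same-sign-towards a≢w a≢b adj-b

  sign-towards-b : ∀ p n → Joins G p w b → Joins G n w b → neg G p ≡ neg G n
  sign-towards-b = same-sign-towards b≢w (a≢b ∘ sym) adj-a

  equal-multiplicity : ∣ edgesBetween G w a ∣ ≡ ∣ edgesBetween G w b ∣
  equal-multiplicity = ≤-antisym
    (multiplicity-bound (a≢w ∘ sym) (λ e u → swap ∘ at-w e u) sign-towards-a)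
    (multiplicity-bound (b≢w ∘ sym) at-w sign-towards-b)

record Enumeration {n} (P : Subset n) : Set where
  field
    element       : Fin ∣ P ∣ → Fin n
    element∈      : ∀ j → element j ∈ P
    index         : ∀ {i} → i ∈ P → Fin ∣ P ∣
    element-index : ∀ {i} (i∈P : i ∈ P) → element (index i∈P) ≡ i
    index-element : ∀ j → index (element∈ j) ≡ j

  index-cong : ∀ {i i'} (i∈P : i ∈ P) (i'∈P : i' ∈ P) → i ≡ i' → index i∈P ≡ index i'∈P
  index-cong i∈P i'∈P refl = cong index ([]=-irrelevant i∈P i'∈P)

enumerate : ∀ {n} (P : Subset n) → Enumeration P
enumerate [] = record { element = λ () ; element∈ = λ () ; index = λ () ; element-index = λ () ; index-element = λ () }
enumerate (true ∷ P) = record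
  { element = λ { zero → zero ; (suc j) → suc (element j) }
  ; element∈ = λ { zero → here ; (suc j) → there (element∈ j) }
  ; index = λ { here → zero ; (there i∈P) → suc (index i∈P) }
  ; element-index = λ { here → refl ; (there i∈P) → cong suc (element-index i∈P) }
  ; index-element = λ { zero → refl ; (suc j) → cong suc (index-element j) } }
  where open Enumeration (enumerate P)
enumerate (false ∷ P) = record
  { element = suc ∘ element
  ; element∈ = there ∘ element∈
  ; index = λ { (there i∈P) → index i∈P }
  ; element-index = λ { (there i∈P) → cong suc (element-index i∈P) }
  ; index-element = index-element }
  where open Enumeration (enumerate P)

module Matching {n} {P Q : Subset n} (∣P∣≡∣Q∣ : ∣ P ∣ ≡ ∣ Q ∣) where

  private
    module P = Enumeration (enumerate P)
    module Q = Enumeration (enumerate Q)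

  match : ∀ {i} → i ∈ P → Fin n
  match i∈P = Q.element (cast ∣P∣≡∣Q∣ (P.index i∈P))

  match∈ : ∀ {i} (i∈P : i ∈ P) → match i∈P ∈ Q
  match∈ i∈P = Q.element∈ _

  match⁻¹ : ∀ {i} → i ∈ Q → Fin n
  match⁻¹ i∈Q = P.element (cast (sym ∣P∣≡∣Q∣) (Q.index i∈Q))

  match⁻¹∈ : ∀ {i} (i∈Q : i ∈ Q) → match⁻¹ i∈Q ∈ P
  match⁻¹∈ i∈Q = P.element∈ _

  match⁻¹-match : ∀ {i} (i∈P : i ∈ P) (m∈Q : match i∈P ∈ Q) → match⁻¹ m∈Q ≡ i
  match⁻¹-match i∈P m∈Q = begin
    P.element (cast _ (Q.index m∈Q))                          ≡⟨ cong (P.element ∘ cast _) (Q.index-cong m∈Q (Q.element∈ _) refl) ⟩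
    P.element (cast _ (Q.index (Q.element∈ (cast _ (P.index i∈P))))) ≡⟨ cong (P.element ∘ cast _) (Q.index-element _) ⟩
    P.element (cast _ (cast ∣P∣≡∣Q∣ (P.index i∈P)))           ≡⟨ cong P.element (cast-involutive (sym ∣P∣≡∣Q∣) ∣P∣≡∣Q∣ _) ⟩
    P.element (P.index i∈P)                                   ≡⟨ P.element-index i∈P ⟩
    _                                                         ∎
    where open ≡-Reasoning

  match-match⁻¹ : ∀ {i} (i∈Q : i ∈ Q) (m∈P : match⁻¹ i∈Q ∈ P) → match m∈P ≡ i
  match-match⁻¹ i∈Q m∈P = begin
    Q.element (cast _ (P.index m∈P))                          ≡⟨ cong (Q.element ∘ cast _) (P.index-cong m∈P (P.element∈ _) refl) ⟩
    Q.element (cast _ (P.index (P.element∈ (cast _ (Q.index i∈Q))))) ≡⟨ cong (Q.element ∘ cast _) (P.index-element _) ⟩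
    Q.element (cast _ (cast (sym ∣P∣≡∣Q∣) (Q.index i∈Q)))     ≡⟨ cong Q.element (cast-involutive ∣P∣≡∣Q∣ (sym ∣P∣≡∣Q∣) _) ⟩
    Q.element (Q.index i∈Q)                                   ≡⟨ Q.element-index i∈Q ⟩
    _                                                         ∎
    where open ≡-Reasoning

  match-cong : ∀ {i i'} (i∈P : i ∈ P) (i'∈P : i' ∈ P) → i ≡ i' → match i∈P ≡ match i'∈P
  match-cong i∈P i'∈P i≡i' = cong (Q.element ∘ cast _) (P.index-cong i∈P i'∈P i≡i')

module Unsubdivide {n' m : ℕ} (ends′ : Fin m → Fin (suc n') × Fin (suc n')) (neg′ : Fin m → Bool) where

  G : SGraph
  G = record { nv = suc n' ; ne = m ; ends = ends′ ; neg = neg′ }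

  module At {w a b : Fin (suc n')} (a≢b : a ≢ b) (a≢w : a ≢ w) (b≢w : b ≢ w)
    (adj-a : Adjacent G w a) (adj-b : Adjacent G w b)
    (at-w : ∀ e u → Joins G e w u → Joins G e w a ⊎ Joins G e w b)
    (sign-a : ∀ p n → Joins G p w a → Joins G n w a → neg G p ≡ neg G n)
    (sign-b : ∀ p n → Joins G p w b → Joins G n w b → neg G p ≡ neg G n)
    (equal-multiplicity : ∣ edgesBetween G w a ∣ ≡ ∣ edgesBetween G w b ∣) where

    A = edgesBetween G w a
    B = edgesBetween G w b
    K = ∁ B

    module K = Enumeration (enumerate K)
    open Matching {P = A} {Q = B} equal-multiplicity

    ¬wa×wb : ∀ {g} → Joins G g w a → ¬ Joins G g w b
    ¬wa×wb g-wa g-wb with Joins-unique G g-wa g-wb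
    ... | inj₁ (_ , a≡b) = a≢b a≡b
    ... | inj₂ (_ , a≡w) = a≢w a≡w

    A⊆K : A ⊆ K
    A⊆K g∈A = x∉p⇒x∈∁p λ g∈B → ¬wa×wb (∈edgesBetween⁻ G g∈A) (∈edgesBetween⁻ G g∈B)

    -- Switching at w makes the w–a edges positive; the w–b edges then carry the sign s.
    σa = neg G (proj₁ adj-a)
    s = neg G (proj₁ adj-b) xor σa

    U : Fin (suc n') → Bool
    U v = if isYes (v ≟ w) then σa else false

    U-≢ : ∀ {v} → v ≢ w → U v ≡ false
    U-≢ {v} v≢w with v ≟ w
    ... | yes v≡w = void (v≢w v≡w)
    ... | no _ = refl

    U-w : U w ≡ σa
    U-w with w ≟ w
    ... | yes _ = refl
    ... | no w≢w = void (w≢w refl)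

    G' = switch G U

    switch-at-w : ∀ {g u} → u ≢ w → Joins G g w u → neg G' g ≡ neg G g xor σa
    switch-at-w {g} u≢w (inj₁ g≡wu) rewrite g≡wu | U-w | U-≢ u≢w = cong (neg G g xor_) (xor-identityʳ σa)
    switch-at-w {g} u≢w (inj₂ g≡uw) rewrite g≡uw | U-w | U-≢ u≢w = refl

    switch-away : ∀ {g} → proj₁ (ends G g) ≢ w → proj₂ (ends G g) ≢ w → neg G' g ≡ neg G g
    switch-away {g} s≢w t≢w rewrite U-≢ s≢w | U-≢ t≢w = xor-identityʳ (neg G g)

    x y : Fin n'
    x = punchOut (a≢w ∘ sym)
    y = punchOut (b≢w ∘ sym)

    data KeptKind (g : Fin m) : Set where
      towards-a : Joins G g w a → KeptKind g
      away      : proj₁ (ends G g) ≢ w → proj₂ (ends G g) ≢ w → KeptKind g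

    keptKind : ∀ {g} → g ∈ K → KeptKind g
    keptKind {g} g∈K with Joins? G g w a | Joins? G g w b
    ... | yes g-wa | _        = towards-a g-wa
    ... | no _     | yes g-wb = void (x∈∁p⇒x∉p g∈K (∈edgesBetween⁺ G g-wb))
    ... | no ¬g-wa | no ¬g-wb =
      away (λ s≡w → avoids (inj₁ (cong (_, proj₂ (ends G g)) s≡w))) (λ t≡w → avoids (inj₂ (cong (proj₁ (ends G g) ,_) t≡w)))
      where avoids : ∀ {u} → ¬ Joins G g w u
            avoids g-wu = [ ¬g-wa , ¬g-wb ]′ (at-w g _ g-wu)

    endsᴷ : ∀ {g} → KeptKind g → Fin n' × Fin n'
    endsᴷ (towards-a _) = x , y
    endsᴷ (away s≢w t≢w) = punchOut (s≢w ∘ sym) , punchOut (t≢w ∘ sym)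

    negᴷ : ∀ {g} → KeptKind g → Bool
    negᴷ (towards-a _) = s
    negᴷ {g} (away _ _) = neg G g

    isTowards-a : ∀ {g} → KeptKind g → Bool
    isTowards-a (towards-a _) = true
    isTowards-a (away _ _) = false

    kindᴴ : (h : Fin ∣ K ∣) → KeptKind (K.element h)
    kindᴴ h = keptKind (K.element∈ h)

    H : SGraph
    H = record { nv = n' ; ne = ∣ K ∣ ; ends = endsᴷ ∘ kindᴴ ; neg = negᴷ ∘ kindᴴ }

    inE : Fin ∣ K ∣ → Bool
    inE = isTowards-a ∘ kindᴴ

    inE⇒towards-a : ∀ h → inE h ≡ true → Joins G (K.element h) w a
    inE⇒towards-a h _ with kindᴴ h
    ... | towards-a g-wa = g-wa

    away⇒¬towards-a : ∀ {g} → proj₁ (ends G g) ≢ w → proj₂ (ends G g) ≢ w → ¬ Joins G g w a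
    away⇒¬towards-a s≢w t≢w (inj₁ refl) = s≢w refl
    away⇒¬towards-a s≢w t≢w (inj₂ refl) = t≢w refl

    towards-a⇒isTowards-a : ∀ {g} (g∈K : g ∈ K) → Joins G g w a → isTowards-a (keptKind g∈K) ≡ true
    towards-a⇒isTowards-a g∈K g-wa with keptKind g∈K
    ... | towards-a _ = refl
    ... | away s≢w t≢w = void (away⇒¬towards-a s≢w t≢w g-wa)

    towards-a⇒inE : ∀ {g} (g∈K : g ∈ K) → Joins G g w a → inE (K.index g∈K) ≡ true
    towards-a⇒inE g∈K g-wa =
      towards-a⇒isTowards-a (K.element∈ _) (subst (λ g → Joins G g w a) (sym (K.element-index g∈K)) g-wa)

    away⇒inE : ∀ {g} (g∈K : g ∈ K) → ¬ Joins G g w a → inE (K.index g∈K) ≡ false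
    away⇒inE g∈K ¬g-wa with kindᴴ (K.index g∈K)
    ... | towards-a g-wa = void (¬g-wa (subst (λ g → Joins G g w a) (K.element-index g∈K) g-wa))
    ... | away _ _ = refl

    toKept : ∀ {g} → g ∈ K → KeptKind g → NewEdge H inE
    toKept g∈K (towards-a g-wa) = toX (K.index g∈K) (towards-a⇒inE g∈K g-wa)
    toKept g∈K (away s≢w t≢w) = old (K.index g∈K) (away⇒inE g∈K (away⇒¬towards-a s≢w t≢w))

    -- A w–b edge is sent to the w–a edge matched with it.
    to : Fin m → NewEdge H inE
    to g with g ∈? B
    ... | yes g∈B = toY (K.index g'∈K) (towards-a⇒inE g'∈K (∈edgesBetween⁻ G (match⁻¹∈ g∈B)))
      where g'∈K = A⊆K (match⁻¹∈ g∈B)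
    ... | no g∉B = toKept (x∉p⇒x∈∁p g∉B) (keptKind (x∉p⇒x∈∁p g∉B))

    from : NewEdge H inE → Fin m
    from (old h _) = K.element h
    from (toX h _) = K.element h
    from (toY h p) = match (∈edgesBetween⁺ G (inE⇒towards-a h p))

    from-to : ∀ g → from (to g) ≡ g
    from-to g with g ∈? B
    ... | yes g∈B = trans (match-cong _ (match⁻¹∈ g∈B) (K.element-index _)) (match-match⁻¹ g∈B _)
    ... | no g∉B with keptKind (x∉p⇒x∈∁p g∉B)
    ...   | towards-a _ = K.element-index _
    ...   | away _ _ = K.element-index _

    private
      old-cong : ∀ {h h'} {p p'} → h ≡ h' → old {H} {inE} h p ≡ old h' p'
      old-cong {p = p} {p'} refl = cong (old _) (uip p p')
      toX-cong : ∀ {h h'} {p p'} → h ≡ h' → toX {H} {inE} h p ≡ toX h' p'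
      toX-cong {p = p} {p'} refl = cong (toX _) (uip p p')
      toY-cong : ∀ {h h'} {p p'} → h ≡ h' → toY {H} {inE} h p ≡ toY h' p'
      toY-cong {p = p} {p'} refl = cong (toY _) (uip p p')

      index-element : ∀ {h} (g∈K : K.element h ∈ K) → K.index g∈K ≡ h
      index-element {h} g∈K = trans (K.index-cong g∈K (K.element∈ h) refl) (K.index-element h)

    to-from : ∀ e → to (from e) ≡ e
    to-from (old h p) with K.element h ∈? B
    ... | yes g∈B = void (x∈∁p⇒x∉p (K.element∈ h) g∈B)
    ... | no g∉B with keptKind (x∉p⇒x∈∁p g∉B)
    ...   | towards-a g-wa = void (false≢true (trans (sym p) (towards-a⇒isTowards-a (K.element∈ h) g-wa)))
    ...   | away _ _ = old-cong (index-element _)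
    to-from (toX h p) with K.element h ∈? B
    ... | yes g∈B = void (x∈∁p⇒x∉p (K.element∈ h) g∈B)
    ... | no g∉B with keptKind (x∉p⇒x∈∁p g∉B)
    ...   | towards-a _ = toX-cong (index-element _)
    ...   | away s≢w t≢w = void (away⇒¬towards-a s≢w t≢w (inE⇒towards-a h p))
    to-from (toY h p) with match (∈edgesBetween⁺ G (inE⇒towards-a h p)) ∈? B
    ... | yes g∈B = toY-cong (trans (K.index-cong _ (K.element∈ h) (match⁻¹-match _ g∈B)) (K.index-element h))
    ... | no g∉B = void (g∉B (match∈ _))

    ψ : Fin m ⤖ NewEdge H inE
    ψ = mk⤖ {to = to} ((λ {g} {g'} eq → trans (sym (from-to g)) (trans (cong from eq) (from-to g'))) ,
                       λ e → from e , λ { refl → to-from e })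

    from-∘-to : ∀ {g e} → to g ≡ e → g ≡ from e
    from-∘-to {g} refl = sym (from-to g)

    old-edge : ∀ h → inE h ≡ false
      → Joins G' (K.element h) (punchIn w (proj₁ (ends H h))) (punchIn w (proj₂ (ends H h)))
        × neg G' (K.element h) ≡ neg H h
    old-edge h p with kindᴴ h
    ... | away s≢w t≢w = inj₁ (sym (cong₂ _,_ (punchIn-punchOut _) (punchIn-punchOut _))) , switch-away s≢w t≢w

    towards-x : ∀ {g} → Joins G g w a → Joins G' g w (punchIn w x) × neg G' g ≡ false
    towards-x g-wa = subst (Joins G _ w) (sym (punchIn-punchOut _)) g-wa
                   , trans (switch-at-w a≢w g-wa) (trans (cong (_xor σa) (sign-a _ _ g-wa (proj₂ adj-a))) (xor-same σa))

    towards-y : ∀ {g} → Joins G g w b → Joins G' g w (punchIn w y) × neg G' g ≡ s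
    towards-y g-wb = subst (Joins G _ w) (sym (punchIn-punchOut _)) g-wb
                   , trans (switch-at-w b≢w g-wb) (cong (_xor σa) (sign-b _ _ g-wb (proj₂ adj-b)))

    subdivision : Subdiv1 H G'
    subdivision = record
      { x = x ; y = y ; x≢y = a≢b ∘ punchOut-injective (a≢w ∘ sym) (b≢w ∘ sym)
      ; inE = inE ; inE-join = λ h p → inj₁ (towards-a-ends h p)
      ; s = s ; inE-sign = towards-a-sign
      ; nonempty = K.index g∈K , towards-a⇒inE g∈K (proj₂ adj-a)
      ; v = w ; φ = punchIn w ; φ-inj = punchIn-injective w _ _ ; φ-≢v = punchInᵢ≢i w
      ; φ-onto = λ u u≢w → punchOut (u≢w ∘ sym) , punchIn-punchOut _
      ; ψ = ψ
      ; ψ-old = λ g h p to≡ → subst (λ g → _ × neg G' g ≡ _) (sym (from-∘-to to≡)) (old-edge h p)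
      ; ψ-toX = λ g h p to≡ → towards-x (subst (λ g → Joins G g w a) (sym (from-∘-to to≡)) (inE⇒towards-a h p))
      ; ψ-toY = λ g h p to≡ → towards-y (subst (λ g → Joins G g w b) (sym (from-∘-to to≡)) (∈edgesBetween⁻ G (match∈ _)))
      }
      where
      g∈K = A⊆K (∈edgesBetween⁺ G (proj₂ adj-a))
      towards-a-ends : ∀ h → inE h ≡ true → ends H h ≡ (x , y)
      towards-a-ends h _ with kindᴴ h
      ... | towards-a _ = refl
      towards-a-sign : ∀ h → inE h ≡ true → neg H h ≡ s
      towards-a-sign h _ with kindᴴ h
      ... | towards-a _ = refl

last-step : ∀ {A : Set} {R : A → A → Set} {x y} → TransClosure R x y → ∃[ z ] R z y
last-step [ r ] = _ , r
last-step (_ ∷ rs) = last-step rs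

subdivision-vertex : ∀ {H G} → Subdiv1 H G → HasVertexWithTwoNeighbours G
subdivision-vertex {G = G} sd =
  v , φ x , φ y , x≢y ∘ φ-inj , φ-≢v x , φ-≢v y , neighbour-x , neighbour-y , only
  where
  open Subdiv1 sd
  e₀ = proj₁ nonempty
  e₀∈E = proj₂ nonempty
  neighbour-x : Adjacent G v (φ x)
  neighbour-x = let g , to≡ = Bijection.surjective ψ (toX e₀ e₀∈E) in g , proj₁ (ψ-toX g e₀ e₀∈E (to≡ refl))
  neighbour-y : Adjacent G v (φ y)
  neighbour-y = let g , to≡ = Bijection.surjective ψ (toY e₀ e₀∈E) in g , proj₁ (ψ-toY g e₀ e₀∈E (to≡ refl))
  only : ∀ u → u ≢ v → Adjacent G v u → u ≡ φ x ⊎ u ≡ φ y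
  only u u≢v (g , g-vu) with Bijection.to ψ g in to≡
  ... | old e p with Joins-unique G g-vu (proj₁ (ψ-old g e p to≡))
  ...   | inj₁ (v≡φ , _) = void (φ-≢v _ (sym v≡φ))
  ...   | inj₂ (v≡φ , _) = void (φ-≢v _ (sym v≡φ))
  only u u≢v (g , g-vu) | toX e p with Joins-unique G g-vu (proj₁ (ψ-toX g e p to≡))
  ...   | inj₁ (_ , u≡φx) = inj₁ u≡φx
  ...   | inj₂ (_ , u≡v) = void (u≢v u≡v)
  only u u≢v (g , g-vu) | toY e p with Joins-unique G g-vu (proj₁ (ψ-toY g e p to≡))
  ...   | inj₁ (_ , u≡φy) = inj₂ u≡φy
  ...   | inj₂ (_ , u≡v) = void (u≢v u≡v)

two-neighbours⇒subdivision : (G : SGraph) (k : ℕ) → 1 ≤ k → Critical G ⊤ k → ¬ Decomposable G k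
  → HasVertexWithTwoNeighbours G → IsProperSubdivision G
two-neighbours⇒subdivision record { nv = zero } _ _ _ _ (() , _)
two-neighbours⇒subdivision G@(record { nv = suc _ ; ends = ends′ ; neg = neg′ }) k k≥1 critical indecomposable
  (w , a , b , a≢b , a≢w , b≢w , adj-a , adj-b , only) =
  H , U , [ subdivision ]
  where
  open TwoNeighbours G k≥1 critical indecomposable a≢b a≢w b≢w adj-a adj-b only
  open Unsubdivide.At ends′ neg′ a≢b a≢w b≢w adj-a adj-b at-w sign-towards-a sign-towards-b equal-multiplicity

theorem3p3 : (G : SGraph) (k : ℕ) → 1 ≤ k → Critical G ⊤ k → ¬ Decomposable G k
    → 3 ≤ nv G → (IsProperSubdivision G ⇔ HasVertexWithTwoNeighbours G)
theorem3p3 G k k≥1 critical indecomposable _ =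
  mk⇔ (λ (_ , _ , subdivisions) → subdivision-vertex (proj₂ (last-step subdivisions)))
      (two-neighbours⇒subdivision G k k≥1 critical indecomposable)
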